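{- Let $A$ be a finite set of items and $\mathcal{F}$ an antimonotonic, triangulated and clique-safe family of itemsets over $A$ whose dependency graph $G$ is connected. Let $T$ be a junction tree of $G$ and $B\subseteq A$. Then any safe set containing $B$ of minimum cardinality among safe sets containing $B$ contains, in addition to the items of $B$, only items belonging to inner separators of $B$ (with respect to $T$).
   Context: An itemset is a subset of $A=\{a_1,\dots,a_K\}$; $S_U(z)=1$ iff $z_i=1$ for all $a_i\in U$. $\mathcal{F}$ is antimonotonic if closed under subsets. A distribution $p$ on $\{0,1\}^K$ satisfies $\theta=(\theta_U)_{U\in\mathcal{F}}$ if $E_p[S_U]=\theta_U$ for all $U\in\mathcal{F}$; "frequencies for $\mathcal{F}$" are such $\theta$ satisfied by some distribution. $C\subseteq A$ is safe if for all frequencies $\theta$ for $\mathcal{F}$, every distribution $q$ on $\{0,1\}^C$ with $E_q[S_U]=\theta_U$ for all $U\in\mathcal{F}$, $U\subseteq C$, has an extension $p$ on $\{0,1\}^K$ (its marginal on the coordinates in $C$ equals $q$) satisfying $\theta$. The dependency graph $G$ has vertex set $A$ and edges $\{a_i,a_j\}$ ($i\ne j$) with $\{a_i,a_j\}\in\mathcal{F}$. $\mathcal{F}$ is triangulated if $G$ has no chordless cycle of length $\ge4$. $\mathcal{F}$ is clique-safe if for every maximal clique $V$ of $G$, every proper subset of $V$ belongs to $\mathcal{F}$. The clique graph has the maximal cliques of $G$ as vertices, two being adjacent iff they share an item. A junction tree is a spanning tree $T$ of the clique graph with the running intersection property: if two cliques contain an item, every clique on the $T$-path between them contains it. Each edge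 of $T$ is a separator, associated with the set of items common to its two cliques. Given $B$, choose for each $b\in B$ a clique $Q_b$ of $T$ with $b\in Q_b$; the inner separators are the separators lying on the $T$-path from $Q_b$ to $Q_c$ for some $b,c\in B$, where the $Q_b$ are chosen so that the number of inner separators is as small as possible (the resulting set of inner separators does not depend on the minimising choice).
   Formalization: The probabilities of the distributions and the frequencies θ in the definition of a safe set are rational. -}

module Defs where

open import Data.Bool using (Bool; true; false; if_then_else_)
open import Data.Nat as ℕ using (ℕ; zero; suc)
open import Data.Fin using (Fin; zero; suc; toℕ; fromℕ)
open import Data.Fin.Subset using (Subset; _∈_; _∉_; _⊆_; _⊂_; _∩_; _∪_; ⁅_⁆; ∣_∣; inside; outside)
open import Data.Fin.Subset.Properties using (_⊆?_)
open import Data.Vec using (Vec; []; _∷_)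
open import Data.Vec.Properties using (≡-dec)
import Data.Bool.Properties as BoolP
open import Data.List using (List; []; _∷_; map; _++_; foldr)
open import Data.Rational using (ℚ; 0ℚ; 1ℚ; _+_; _*_; _≤_)
open import Data.Product using (Σ; ∃; ∃-syntax; _×_; _,_)
open import Data.Sum using (_⊎_)
open import Relation.Nullary using (¬_; yes; no; does)
open import Relation.Binary.PropositionalEquality using (_≡_; _≢_)
open import Relation.Binary.Construct.Closure.ReflexiveTransitive using (Star)
open import Function.Definitions using (Injective)

CycSucc : (n : ℕ) → Fin n → Fin n → Set
CycSucc n i j = (toℕ j ≡ suc (toℕ i)) ⊎ ((suc (toℕ i) ≡ n) × (toℕ j ≡ 0))

record Cycle {V : Set} (R : V → V → Set) (n : ℕ) : Set where
  field
    vert : Fin n → V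
    inj  : Injective _≡_ _≡_ vert
    step : ∀ i j → CycSucc n i j → R (vert i) (vert j)

Chordless : {V : Set} {R : V → V → Set} {n : ℕ} → Cycle R n → Set
Chordless {R = R} {n} c =
  ∀ i j → R (Cycle.vert c i) (Cycle.vert c j) → CycSucc n i j ⊎ CycSucc n j i

record SimplePath {V : Set} (R : V → V → Set) (x y : V) : Set where
  field
    len   : ℕ
    vert  : Fin (suc len) → V
    inj   : Injective _≡_ _≡_ vert
    start : vert zero ≡ x
    end   : vert (fromℕ len) ≡ y
    step  : ∀ k k' → toℕ k' ≡ suc (toℕ k) → R (vert k) (vert k')

Connected : {V : Set} → (V → V → Set) → Set
Connected R = ∀ x y → Star R x y

Acyclic : {V : Set} → (V → V → Set) → Set
Acyclic R = ∀ n → 3 ℕ.≤ n → ¬ Cycle R n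

Family : ℕ → Set₁
Family K = Subset K → Set

Antimonotonic : ∀ {K} → Family K → Set
Antimonotonic F = ∀ U V → V ⊆ U → F U → F V

Adj : ∀ {K} → Family K → Fin K → Fin K → Set
Adj F i j = i ≢ j × F (⁅ i ⁆ ∪ ⁅ j ⁆)

Triangulated : ∀ {K} → Family K → Set
Triangulated F = ∀ n → 4 ℕ.≤ n → (c : Cycle (Adj F) n) → ¬ Chordless c

IsClique : ∀ {K} → Family K → Subset K → Set
IsClique F V = ∀ i j → i ∈ V → j ∈ V → i ≢ j → Adj F i j

IsMaxClique : ∀ {K} → Family K → Subset K → Set
IsMaxClique F V = IsClique F V × (∀ W → IsClique F W → V ⊆ W → W ≡ V)

CliqueSafe : ∀ {K} → Family K → Set
CliqueSafe F = ∀ V → IsMaxClique F V → ∀ U → U ⊂ V → F U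

-- Junction trees.  The maximal cliques are enumerated (without
-- repetition) by cl : Fin m → Subset K; the tree has edge list
-- edges : Fin e → Fin m × Fin m.

TAdj : ∀ {m e} → (Fin e → Fin m × Fin m) → Fin m → Fin m → Set
TAdj edges Q Q' = ∃[ i ] (edges i ≡ (Q , Q') ⊎ edges i ≡ (Q' , Q))

OnPath : ∀ {m e} → (Fin e → Fin m × Fin m) → Fin m → Fin m → Fin e → Set
OnPath edges Q Q' i =
  Σ (SimplePath (TAdj edges) Q Q') λ p →
    ∃[ k ] ∃[ k' ] (toℕ k' ≡ suc (toℕ k)) ×
      ((edges i ≡ (SimplePath.vert p k , SimplePath.vert p k'))
       ⊎ (edges i ≡ (SimplePath.vert p k' , SimplePath.vert p k)))

record JunctionTree {K : ℕ} (F : Family K) (m e : ℕ)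
       (cl : Fin m → Subset K) (edges : Fin e → Fin m × Fin m) : Set where
  field
    cl-inj   : Injective _≡_ _≡_ cl
    cl-max   : ∀ Q → IsMaxClique F (cl Q)
    cl-all   : ∀ V → IsMaxClique F V → ∃[ Q ] cl Q ≡ V
    -- edges: pairwise distinct (unordered) edges of the clique graph
    edge-inj  : Injective _≡_ _≡_ edges
    edge-sym  : ∀ i j Q Q' → edges i ≡ (Q , Q') → edges j ≢ (Q' , Q)
    edge-loop : ∀ i Q → edges i ≢ (Q , Q)
    edge-cg   : ∀ i Q Q' → edges i ≡ (Q , Q') → ∃[ a ] (a ∈ cl Q × a ∈ cl Q')
    connected : Connected (TAdj edges)
    acyclic   : Acyclic (TAdj edges)
    rip : ∀ Q Q' a → a ∈ cl Q → a ∈ cl Q' →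
          (p : SimplePath (TAdj edges) Q Q') → ∀ k → a ∈ cl (SimplePath.vert p k)

Sep : ∀ {K m e} → (Fin m → Subset K) → (Fin e → Fin m × Fin m) → Fin e → Subset K
Sep cl edges i with edges i
... | (Q , Q') = cl Q ∩ cl Q'

record CliqueChoice {K m : ℕ} (cl : Fin m → Subset K) (B : Subset K) : Set where
  field
    pick : ∀ b → b ∈ B → Fin m
    pick-∈ : ∀ b (h : b ∈ B) → b ∈ cl (pick b h)

InnerFor : ∀ {K m e} {cl : Fin m → Subset K} {B : Subset K} →
           (Fin e → Fin m × Fin m) → CliqueChoice cl B → Fin e → Set
InnerFor {B = B} edges ch i =
  ∃[ b ] ∃[ c ] Σ (b ∈ B) λ hb → Σ (c ∈ B) λ hc →
    OnPath edges (CliqueChoice.pick ch b hb) (CliqueChoice.pick ch c hc) i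

InnerSet : ∀ {K m e} {cl : Fin m → Subset K} {B : Subset K} →
           (Fin e → Fin m × Fin m) → CliqueChoice cl B → Subset e → Set
InnerSet edges ch S = ∀ i → (i ∈ S → InnerFor edges ch i) × (InnerFor edges ch i → i ∈ S)

MinimalChoice : ∀ {K m e} {cl : Fin m → Subset K} {B : Subset K} →
                (Fin e → Fin m × Fin m) → CliqueChoice cl B → Set
MinimalChoice {cl = cl} {B} edges ch =
  ∀ (ch' : CliqueChoice cl B) S S' → InnerSet edges ch S → InnerSet edges ch' S' →
    ∣ S ∣ ℕ.≤ ∣ S' ∣

-- Distributions on {0,1}^K (points are 0/1 vectors = Subset K),
-- with rational probabilities.

allPoints : ∀ n → List (Subset n)
allPoints zero = [] ∷ []
allPoints (suc n) = map (outside ∷_) (allPoints n) ++ map (inside ∷_) (allPoints n)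

sumℚ : List ℚ → ℚ
sumℚ = foldr _+_ 0ℚ

Σpts : ∀ K → (Subset K → ℚ) → ℚ
Σpts K f = sumℚ (map f (allPoints K))

record Dist (K : ℕ) : Set where
  field
    prob    : Subset K → ℚ
    nonneg  : ∀ z → 0ℚ ≤ prob z
    total   : Σpts K prob ≡ 1ℚ
open Dist public

Ind : ∀ {K} → Subset K → Subset K → ℚ
Ind U z = if does (U ⊆? z) then 1ℚ else 0ℚ

Freq : ∀ {K} → Dist K → Subset K → ℚ
Freq {K} p U = Σpts K (λ z → prob p z * Ind U z)

Satisfies : ∀ {K} → Family K → Dist K → (Subset K → ℚ) → Set
Satisfies F p θ = ∀ U → F U → Freq p U ≡ θ U

-- θ is a frequency vector for F (values of θ off F are irrelevant)
IsFrequencies : ∀ {K} → Family K → (Subset K → ℚ) → Set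
IsFrequencies F θ = ∃[ p ] Satisfies F p θ

-- a distribution on {0,1}^C is encoded as a distribution on {0,1}^K
-- supported on points z ⊆ C  (z ↦ z restricted to C)
SupportedOn : ∀ {K} → Subset K → Dist K → Set
SupportedOn C q = ∀ z → z ∩ C ≢ z → prob q z ≡ 0ℚ

Marginal : ∀ {K} → Subset K → Dist K → Subset K → ℚ
Marginal {K} C p z' =
  Σpts K (λ z → if does (≡-dec BoolP._≟_ (z ∩ C) z') then prob p z else 0ℚ)

Safe : ∀ {K} → Family K → Subset K → Set
Safe F C =
  ∀ θ → IsFrequencies F θ →
  ∀ (q : Dist _) → SupportedOn C q →
  (∀ U → F U → U ⊆ C → Freq q U ≡ θ U) →
  ∃[ p ] (Satisfies F p θ × (∀ z' → z' ⊆ C → Marginal C p z' ≡ prob q z'))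

MinSafeContaining : ∀ {K} → Family K → Subset K → Subset K → Set
MinSafeContaining F B C =
  Safe F C × B ⊆ C × (∀ C' → Safe F C' → B ⊆ C' → ∣ C ∣ ℕ.≤ ∣ C' ∣)

-- A bypass of X is a path of G whose inner items lie outside X.  In a safe
-- set C any two items joined by a bypass are adjacent: otherwise, with Y the
-- part of G reached by the bypass, the frequencies of ½δ_∅ + ½δ_Y force u ⇒ v,
-- while the uniform distribution on the subsets of {u, v} matches them inside
-- C.  Conversely, for a clique-safe family with a junction tree, this makes
-- the neighbourhood in X of every component of G − X a clique of F, and a
-- distribution on X extends by gluing the components on one at a time, each
-- conditionally independent of the rest given its neighbourhood; so X is safe.
-- The property passes from a safe C ⊇ B to C ∩ A, where A is B together with
-- the inner separators, by separating along an inner edge of the junction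
-- tree.  Hence C ∩ A is a safe superset of B, and minimality of C gives C ⊆ A.

module Submission where

open import Defs
open import Algebra.Bundles using (CommutativeMonoid)
open import Algebra.Properties.Group using (∙-cancelʳ)
open import Data.Bool using (Bool; true; false; if_then_else_)
import Data.Bool.Properties as BoolP
open import Data.Empty using (⊥; ⊥-elim)
open import Data.Fin using (Fin; zero; suc; toℕ; fromℕ<)
import Data.Fin.Properties as FinP
open import Data.Fin.Subset using (Subset; _∈_; _∉_; _⊆_; _∩_; _∪_; ∁; ⁅_⁆; inside; outside) renaming (⊥ to ∅)
open import Data.Fin.Subset.Properties
  using ( _∈?_; _⊆?_; drop-there; ⊥⊆; ∉⊥; p∩q⊆q; p⊆p∪q; q⊆p∪q; x∈p∪q⁺; x∈p∪q⁻; x∈p∩q⁺; x∈p∩q⁻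
        ; x∈⁅x⁆; x∈⁅y⁆⇒x≡y; x∉p⇒x∈∁p; ∪-comm; ∩-distribˡ-∪; ⊆-antisym; p⊂q⇒∣p∣<∣q∣ )
import Data.Integer as ℤ
open import Data.List using (List; []; _∷_; map; _++_; allFin)
open import Data.List.Membership.Propositional using () renaming (_∈_ to _∈ₗ_)
open import Data.List.Membership.Propositional.Properties using (∈-allFin)
open import Data.List.Properties using (map-++; map-∘)
open import Data.List.Relation.Unary.All using (All; []; _∷_)
open import Data.List.Relation.Unary.Any using (here; there)
import Data.Nat as ℕ
open import Data.Nat using (ℕ; zero; suc; _∸_; _≤_; _<_; z≤n; s≤s)
import Data.Nat.Properties as ℕP
open import Data.Product using (Σ; ∃-syntax; _×_; _,_; proj₁; proj₂) renaming (swap to ×-swap)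
import Data.Rational as ℚ
open import Data.Rational using (ℚ; mkℚ; 0ℚ; 1ℚ; _+_; _*_; _-_; _/_; 1/_; nonNegative)
import Data.Rational.Properties as Q
open import Data.Rational.Solver using (module +-*-Solver)
open import Data.Sum using (_⊎_; inj₁; inj₂; [_,_]; swap)
open import Data.Vec using ([]; _∷_; here; there; tabulate)
open import Data.Vec.Properties using (≡-dec; lookup∘tabulate; []=⇒lookup; lookup⇒[]=)
open import Effect.Monad using (RawMonad)
open import Function using (id; _∘_; case_of_)
open import Relation.Binary.Construct.Closure.ReflexiveTransitive using (Star; ε; _◅_; _◅◅_; gmap; reverse)
open import Relation.Binary.PropositionalEquality hiding ([_])
open import Relation.Nullary using (¬_; Dec; yes; no; does)
open import Relation.Nullary.Decidable using (dec-true; dec-false; decidable-stable; _×-dec_; _⊎-dec_; ¬?; _→-dec_)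
open import Relation.Nullary.Decidable.Core using (¬¬-excluded-middle)
open import Relation.Nullary.Negation using (¬¬-Monad)
open import Algebra.Properties.CommutativeSemigroup
  (CommutativeMonoid.commutativeSemigroup Q.+-0-commutativeMonoid)
  using () renaming (interchange to +-interchange)
open +-*-Solver using (solve; _:=_; _:+_; _:*_; _:-_; con)

private
  variable
    n : ℕ

sumℚ-++ : ∀ (xs ys : List ℚ) → sumℚ (xs ++ ys) ≡ sumℚ xs + sumℚ ys
sumℚ-++ []       ys = sym (Q.+-identityˡ _)
sumℚ-++ (x ∷ xs) ys = trans (cong (x +_) (sumℚ-++ xs ys)) (sym (Q.+-assoc x _ _))

Σpts-split : ∀ n (f : Subset (suc n) → ℚ) →
  Σpts (suc n) f ≡ Σpts n (f ∘ (outside ∷_)) + Σpts n (f ∘ (inside ∷_))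
Σpts-split n f = begin
  sumℚ (map f (map (outside ∷_) zs ++ map (inside ∷_) zs))
    ≡⟨ cong sumℚ (map-++ f (map (outside ∷_) zs) _) ⟩
  sumℚ (map f (map (outside ∷_) zs) ++ map f (map (inside ∷_) zs))
    ≡⟨ sumℚ-++ (map f (map (outside ∷_) zs)) _ ⟩
  sumℚ (map f (map (outside ∷_) zs)) + sumℚ (map f (map (inside ∷_) zs))
    ≡⟨ sym (cong₂ _+_ (cong sumℚ (map-∘ zs)) (cong sumℚ (map-∘ zs))) ⟩
  Σpts n (f ∘ (outside ∷_)) + Σpts n (f ∘ (inside ∷_)) ∎
  where
  open ≡-Reasoning
  zs = allPoints n

Σpts-cong : ∀ n {f g : Subset n → ℚ} → (∀ z → f z ≡ g z) → Σpts n f ≡ Σpts n g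
Σpts-cong n f≗g = cong sumℚ (go (allPoints n))
  where
  go : ∀ zs → map _ zs ≡ map _ zs
  go []       = refl
  go (z ∷ zs) = cong₂ _∷_ (f≗g z) (go zs)

Σpts-0 : ∀ n → Σpts n (λ _ → 0ℚ) ≡ 0ℚ
Σpts-0 zero    = refl
Σpts-0 (suc n) = trans (Σpts-split n _) (cong₂ _+_ (Σpts-0 n) (Σpts-0 n))

Σpts-+ : ∀ n (f g : Subset n → ℚ) → Σpts n (λ z → f z + g z) ≡ Σpts n f + Σpts n g
Σpts-+ zero f g =
  solve 2 (λ a b → (a :+ b) :+ con 0ℚ := (a :+ con 0ℚ) :+ (b :+ con 0ℚ)) refl (f []) (g [])
Σpts-+ (suc n) f g = begin
  Σpts (suc n) (λ z → f z + g z)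
    ≡⟨ Σpts-split n _ ⟩
  Σpts n (λ z → f₀ z + g₀ z) + Σpts n (λ z → f₁ z + g₁ z)
    ≡⟨ cong₂ _+_ (Σpts-+ n f₀ g₀) (Σpts-+ n f₁ g₁) ⟩
  (Σpts n f₀ + Σpts n g₀) + (Σpts n f₁ + Σpts n g₁)
    ≡⟨ +-interchange (Σpts n f₀) (Σpts n g₀) (Σpts n f₁) (Σpts n g₁) ⟩
  (Σpts n f₀ + Σpts n f₁) + (Σpts n g₀ + Σpts n g₁)
    ≡⟨ sym (cong₂ _+_ (Σpts-split n f) (Σpts-split n g)) ⟩
  Σpts (suc n) f + Σpts (suc n) g ∎
  where
  open ≡-Reasoning
  f₀ = f ∘ (outside ∷_); f₁ = f ∘ (inside ∷_)
  g₀ = g ∘ (outside ∷_); g₁ = g ∘ (inside ∷_)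

Σpts-*ˡ : ∀ n c (f : Subset n → ℚ) → Σpts n (λ z → c * f z) ≡ c * Σpts n f
Σpts-*ˡ zero c f = solve 2 (λ c a → c :* a :+ con 0ℚ := c :* (a :+ con 0ℚ)) refl c (f [])
Σpts-*ˡ (suc n) c f = begin
  Σpts (suc n) (λ z → c * f z)
    ≡⟨ Σpts-split n _ ⟩
  Σpts n (λ z → c * f₀ z) + Σpts n (λ z → c * f₁ z)
    ≡⟨ cong₂ _+_ (Σpts-*ˡ n c f₀) (Σpts-*ˡ n c f₁) ⟩
  c * Σpts n f₀ + c * Σpts n f₁
    ≡⟨ sym (Q.*-distribˡ-+ c _ _) ⟩
  c * (Σpts n f₀ + Σpts n f₁)
    ≡⟨ cong (c *_) (sym (Σpts-split n f)) ⟩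
  c * Σpts (suc n) f ∎
  where
  open ≡-Reasoning
  f₀ = f ∘ (outside ∷_); f₁ = f ∘ (inside ∷_)

Σpts-nonneg : ∀ n (f : Subset n → ℚ) → (∀ z → 0ℚ ℚ.≤ f z) → 0ℚ ℚ.≤ Σpts n f
Σpts-nonneg zero    f f≥0 = Q.+-mono-≤ (f≥0 []) Q.≤-refl
Σpts-nonneg (suc n) f f≥0 = subst (0ℚ ℚ.≤_) (sym (Σpts-split n f))
  (Q.+-mono-≤ (Σpts-nonneg n _ (f≥0 ∘ (outside ∷_))) (Σpts-nonneg n _ (f≥0 ∘ (inside ∷_))))

+-nonneg-≡0ˡ : ∀ {a b} → 0ℚ ℚ.≤ a → 0ℚ ℚ.≤ b → a + b ≡ 0ℚ → a ≡ 0ℚ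
+-nonneg-≡0ˡ {a} a≥0 b≥0 a+b≡0 = Q.≤-antisym
  (Q.≤-trans (Q.≤-reflexive (sym (Q.+-identityʳ a))) (subst (a + 0ℚ ℚ.≤_) a+b≡0 (Q.+-monoʳ-≤ a b≥0)))
  a≥0

Σpts-nonneg-≡0 : ∀ n (f : Subset n → ℚ) → (∀ z → 0ℚ ℚ.≤ f z) → Σpts n f ≡ 0ℚ → ∀ z → f z ≡ 0ℚ
Σpts-nonneg-≡0 zero f f≥0 Σ≡0 [] = trans (sym (Q.+-identityʳ _)) Σ≡0
Σpts-nonneg-≡0 (suc n) f f≥0 Σ≡0 (b ∷ z) = Σpts-nonneg-≡0 n (f ∘ (b ∷_)) (f≥0 ∘ (b ∷_)) (part b) z
  where
  Σ₀≥0 : 0ℚ ℚ.≤ Σpts n (f ∘ (outside ∷_))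
  Σ₀≥0 = Σpts-nonneg n (f ∘ (outside ∷_)) (f≥0 ∘ (outside ∷_))
  Σ₁≥0 : 0ℚ ℚ.≤ Σpts n (f ∘ (inside ∷_))
  Σ₁≥0 = Σpts-nonneg n (f ∘ (inside ∷_)) (f≥0 ∘ (inside ∷_))
  halves≡0 : Σpts n (f ∘ (outside ∷_)) + Σpts n (f ∘ (inside ∷_)) ≡ 0ℚ
  halves≡0 = trans (sym (Σpts-split n f)) Σ≡0
  part : ∀ b → Σpts n (f ∘ (b ∷_)) ≡ 0ℚ
  part outside = +-nonneg-≡0ˡ Σ₀≥0 Σ₁≥0 halves≡0
  part inside  = +-nonneg-≡0ˡ Σ₁≥0 Σ₀≥0 (trans (Q.+-comm (Σpts n (f ∘ (inside ∷_))) _) halves≡0)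

*-nonneg : ∀ {a b} → 0ℚ ℚ.≤ a → 0ℚ ℚ.≤ b → 0ℚ ℚ.≤ a * b
*-nonneg {a} {b} a≥0 b≥0 =
  subst (λ x → x ℚ.≤ a * b) (Q.*-zeroʳ a) (Q.*-monoˡ-≤-nonNeg a {{nonNegative a≥0}} b≥0)

infix 5 _⊆ᵇ_

-- Defined through _⊆?_, so that it reduces entrywise on cons cells and
-- Ind U z is definitionally  if U ⊆ᵇ z then 1ℚ else 0ℚ.
_⊆ᵇ_ : Subset n → Subset n → Bool
p ⊆ᵇ q = does (p ⊆? q)

⊆ᵇ⇒⊆ : ∀ (p q : Subset n) → p ⊆ᵇ q ≡ true → p ⊆ q
⊆ᵇ⇒⊆ p q p⊆ᵇq with p ⊆? q
... | yes p⊆q = p⊆q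

⊆⇒⊆ᵇ : ∀ (p q : Subset n) → p ⊆ q → p ⊆ᵇ q ≡ true
⊆⇒⊆ᵇ p q = dec-true (p ⊆? q)

⊈ᵇ⇒witness : ∀ (p q : Subset n) → p ⊆ᵇ q ≡ false → ∃[ t ] (t ∈ p × t ∉ q)
⊈ᵇ⇒witness []            []            ()
⊈ᵇ⇒witness (inside ∷ p)  (outside ∷ q) _ = zero , here , λ ()
⊈ᵇ⇒witness (inside ∷ p)  (inside ∷ q)  p⊈q with ⊈ᵇ⇒witness p q p⊈q
... | t , t∈p , t∉q = suc t , there t∈p , t∉q ∘ drop-there
⊈ᵇ⇒witness (outside ∷ p) (_ ∷ q)       p⊈q with ⊈ᵇ⇒witness p q p⊈q
... | t , t∈p , t∉q = suc t , there t∈p , t∉q ∘ drop-there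

disjoint⇒⊆ᵇ∁ : ∀ (p q : Subset n) → (∀ {t} → t ∈ p → t ∉ q) → p ⊆ᵇ ∁ q ≡ true
disjoint⇒⊆ᵇ∁ p q p#q = ⊆⇒⊆ᵇ p (∁ q) (x∉p⇒x∈∁p ∘ p#q)

⊆ᵇ⇒∩≡ : ∀ (p q : Subset n) → p ⊆ᵇ q ≡ true → p ∩ q ≡ p
⊆ᵇ⇒∩≡ []            []            _   = refl
⊆ᵇ⇒∩≡ (outside ∷ p) (_ ∷ q)       p⊆q = cong (outside ∷_) (⊆ᵇ⇒∩≡ p q p⊆q)
⊆ᵇ⇒∩≡ (inside ∷ p)  (inside ∷ q)  p⊆q = cong (inside ∷_) (⊆ᵇ⇒∩≡ p q p⊆q)

∩⊆ᵇʳ : ∀ (p q : Subset n) → p ∩ q ⊆ᵇ q ≡ true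
∩⊆ᵇʳ p q = ⊆⇒⊆ᵇ (p ∩ q) q (p∩q⊆q p q)

∩-∪-recompose : ∀ (y D N : Subset n) → y ⊆ᵇ D ∪ N ≡ true → (y ∩ D) ∪ (y ∩ N) ≡ y
∩-∪-recompose y D N y⊆D∪N = trans (sym (∩-distribˡ-∪ y D N)) (⊆ᵇ⇒∩≡ y (D ∪ N) y⊆D∪N)

if-+ : ∀ b {x y} → (if b then x + y else 0ℚ) ≡ (if b then x else 0ℚ) + (if b then y else 0ℚ)
if-+ true  = refl
if-+ false = refl

if-≡0 : ∀ b {x} → x ≡ 0ℚ → (if b then x else 0ℚ) ≡ 0ℚ
if-≡0 true  x≡0 = x≡0
if-≡0 false _   = refl

if-nonneg : ∀ b {x} → 0ℚ ℚ.≤ x → 0ℚ ℚ.≤ (if b then x else 0ℚ)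
if-nonneg true  x≥0 = x≥0
if-nonneg false _   = Q.≤-refl

marginal : Subset n → (Subset n → ℚ) → Subset n → ℚ
marginal {n} S f w = Σpts n (λ z → if does (≡-dec BoolP._≟_ (z ∩ S) w) then f z else 0ℚ)

freq : (Subset n → ℚ) → Subset n → ℚ
freq {n} f U = Σpts n (λ z → f z * Ind U z)

SupportedWithin : Subset n → (Subset n → ℚ) → Set
SupportedWithin S f = ∀ z → z ⊆ᵇ S ≡ false → f z ≡ 0ℚ

sum-head : (Subset (suc n) → ℚ) → Subset n → ℚ
sum-head f z = f (outside ∷ z) + f (inside ∷ z)

module _ {n} (S : Subset n) (f : Subset (suc n) → ℚ) (w : Subset n) where

  marginal-outside-split : marginal (outside ∷ S) f (outside ∷ w)
                         ≡ marginal S (f ∘ (outside ∷_)) w + marginal S (f ∘ (inside ∷_)) w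
  marginal-outside-split = Σpts-split n _

  marginal-outside-∉ : marginal (outside ∷ S) f (inside ∷ w) ≡ 0ℚ
  marginal-outside-∉ = trans (Σpts-split n _) (cong₂ _+_ (Σpts-0 n) (Σpts-0 n))

  marginal-inside : ∀ b → marginal (inside ∷ S) f (b ∷ w) ≡ marginal S (f ∘ (b ∷_)) w
  marginal-inside outside =
    trans (Σpts-split n _) (trans (cong (marginal S (f ∘ (outside ∷_)) w +_) (Σpts-0 n)) (Q.+-identityʳ _))
  marginal-inside inside =
    trans (Σpts-split n _) (trans (cong (_+ marginal S (f ∘ (inside ∷_)) w) (Σpts-0 n)) (Q.+-identityˡ _))

marginal-[] : ∀ (f : Subset 0 → ℚ) → marginal [] f [] ≡ f []
marginal-[] f = Q.+-identityʳ _

marginal-+ : ∀ S (f g : Subset n → ℚ) w →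
  marginal S (λ z → f z + g z) w ≡ marginal S f w + marginal S g w
marginal-+ {n} S f g w = trans (Σpts-cong n (λ z → if-+ (does (≡-dec _ (z ∩ S) w)))) (Σpts-+ n _ _)

marginal-outside : ∀ S (f : Subset (suc n) → ℚ) w →
  marginal (outside ∷ S) f (outside ∷ w) ≡ marginal S (sum-head f) w
marginal-outside S f w = trans (marginal-outside-split S f w) (sym (marginal-+ S _ _ w))

marginal-zero : ∀ S (f : Subset n → ℚ) → (∀ z → f z ≡ 0ℚ) → ∀ w → marginal S f w ≡ 0ℚ
marginal-zero {n} S f f≡0 w =
  trans (Σpts-cong n (λ z → if-≡0 (does (≡-dec _ (z ∩ S) w)) (f≡0 z))) (Σpts-0 n)

marginal-nonneg : ∀ S (f : Subset n → ℚ) → (∀ z → 0ℚ ℚ.≤ f z) → ∀ w → 0ℚ ℚ.≤ marginal S f w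
marginal-nonneg {n} S f f≥0 w =
  Σpts-nonneg n _ (λ z → if-nonneg (does (≡-dec _ (z ∩ S) w)) (f≥0 z))

marginal-⊈ : ∀ S (f : Subset n → ℚ) w → w ⊆ᵇ S ≡ false → marginal S f w ≡ 0ℚ
marginal-⊈ []            f []           ()
marginal-⊈ (outside ∷ S) f (outside ∷ w) w⊈S =
  trans (marginal-outside-split S f w) (cong₂ _+_ (marginal-⊈ S _ w w⊈S) (marginal-⊈ S _ w w⊈S))
marginal-⊈ (outside ∷ S) f (inside ∷ w)  w⊈S = marginal-outside-∉ S f w
marginal-⊈ (inside ∷ S)  f (outside ∷ w) w⊈S =
  trans (marginal-inside S f w outside) (marginal-⊈ S _ w w⊈S)
marginal-⊈ (inside ∷ S)  f (inside ∷ w)  w⊈S =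
  trans (marginal-inside S f w inside) (marginal-⊈ S _ w w⊈S)

module _ {n} (S : Subset n) (f : Subset (suc n) → ℚ) where

  supported-tail : ∀ {s} b → SupportedWithin (s ∷ S) f → SupportedWithin S (f ∘ (b ∷_))
  supported-tail {outside} outside supp z   = supp (outside ∷ z)
  supported-tail {outside} inside  supp z _ = supp (inside ∷ z) refl
  supported-tail {inside}  outside supp z   = supp (outside ∷ z)
  supported-tail {inside}  inside  supp z   = supp (inside ∷ z)

  supported-outside : SupportedWithin (outside ∷ S) f → ∀ z → f (inside ∷ z) ≡ 0ℚ
  supported-outside supp z = supp (inside ∷ z) refl

marginal-supported : ∀ S (f : Subset n → ℚ) → SupportedWithin S f →
  ∀ w → w ⊆ᵇ S ≡ true → marginal S f w ≡ f w
marginal-supported []            f supp [] _ = marginal-[] f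
marginal-supported (outside ∷ S) f supp (outside ∷ w) w⊆S = begin
  marginal (outside ∷ S) f (outside ∷ w)
    ≡⟨ marginal-outside-split S f w ⟩
  marginal S (f ∘ (outside ∷_)) w + marginal S (f ∘ (inside ∷_)) w
    ≡⟨ cong₂ _+_ (marginal-supported S _ (supported-tail S f outside supp) w w⊆S)
                 (marginal-zero S _ (supported-outside S f supp) w) ⟩
  f (outside ∷ w) + 0ℚ
    ≡⟨ Q.+-identityʳ _ ⟩
  f (outside ∷ w) ∎
  where open ≡-Reasoning
marginal-supported (inside ∷ S)  f supp (outside ∷ w) w⊆S =
  trans (marginal-inside S f w outside) (marginal-supported S _ (supported-tail S f outside supp) w w⊆S)
marginal-supported (inside ∷ S)  f supp (inside ∷ w) w⊆S =
  trans (marginal-inside S f w inside) (marginal-supported S _ (supported-tail S f inside supp) w w⊆S)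

freq-+ : ∀ (f g : Subset n → ℚ) U → freq (λ z → f z + g z) U ≡ freq f U + freq g U
freq-+ {n} f g U = trans (Σpts-cong n (λ z → Q.*-distribʳ-+ (Ind U z) (f z) (g z))) (Σpts-+ n _ _)

module _ {n} (f : Subset (suc n) → ℚ) (U : Subset n) where

  freq-outside : freq f (outside ∷ U) ≡ freq (sum-head f) U
  freq-outside = trans (Σpts-split n _) (sym (freq-+ (f ∘ (outside ∷_)) _ U))

  freq-inside : freq f (inside ∷ U) ≡ freq (f ∘ (inside ∷_)) U
  freq-inside = begin
    freq f (inside ∷ U)
      ≡⟨ Σpts-split n _ ⟩
    Σpts n (λ z → f (outside ∷ z) * 0ℚ) + freq (f ∘ (inside ∷_)) U
      ≡⟨ cong (_+ freq (f ∘ (inside ∷_)) U)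
              (trans (Σpts-cong n (λ z → Q.*-zeroʳ (f (outside ∷ z)))) (Σpts-0 n)) ⟩
    0ℚ + freq (f ∘ (inside ∷_)) U
      ≡⟨ Q.+-identityˡ _ ⟩
    freq (f ∘ (inside ∷_)) U ∎
    where open ≡-Reasoning

freq-[] : ∀ (f : Subset 0 → ℚ) → freq f [] ≡ f []
freq-[] f = trans (Q.+-identityʳ _) (Q.*-identityʳ _)

freq-∅ : ∀ {n} (f : Subset n → ℚ) → freq f ∅ ≡ Σpts n f
freq-∅ {n} f = Σpts-cong n λ z →
  trans (cong (λ b → f z * (if b then 1ℚ else 0ℚ)) (dec-true (∅ ⊆? z) ⊥⊆)) (Q.*-identityʳ (f z))

marginal⇒freq : ∀ S U (f g : Subset n → ℚ) → U ⊆ᵇ S ≡ true →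
  (∀ w → marginal S f w ≡ marginal S g w) → freq f U ≡ freq g U
marginal⇒freq [] [] f g _ f~g = begin
  freq f []        ≡⟨ freq-[] f ⟩
  f []             ≡⟨ sym (marginal-[] f) ⟩
  marginal [] f [] ≡⟨ f~g [] ⟩
  marginal [] g [] ≡⟨ marginal-[] g ⟩
  g []             ≡⟨ sym (freq-[] g) ⟩
  freq g []        ∎
  where open ≡-Reasoning
marginal⇒freq (inside ∷ S) (outside ∷ U) f g U⊆S f~g = begin
  freq f (outside ∷ U)                                  ≡⟨ freq-outside f U ⟩
  freq (sum-head f) U                                   ≡⟨ freq-+ (f ∘ (outside ∷_)) _ U ⟩
  freq (f ∘ (outside ∷_)) U + freq (f ∘ (inside ∷_)) U  ≡⟨ cong₂ _+_ (tail~ outside) (tail~ inside) ⟩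
  freq (g ∘ (outside ∷_)) U + freq (g ∘ (inside ∷_)) U  ≡⟨ sym (freq-+ (g ∘ (outside ∷_)) _ U) ⟩
  freq (sum-head g) U                                   ≡⟨ sym (freq-outside g U) ⟩
  freq g (outside ∷ U)                                  ∎
  where
  open ≡-Reasoning
  tail~ : ∀ b → freq (f ∘ (b ∷_)) U ≡ freq (g ∘ (b ∷_)) U
  tail~ b = marginal⇒freq S U _ _ U⊆S λ w →
    trans (sym (marginal-inside S f w b)) (trans (f~g (b ∷ w)) (marginal-inside S g w b))
marginal⇒freq (inside ∷ S) (inside ∷ U) f g U⊆S f~g = begin
  freq f (inside ∷ U)       ≡⟨ freq-inside f U ⟩
  freq (f ∘ (inside ∷_)) U  ≡⟨ marginal⇒freq S U _ _ U⊆S tail~ ⟩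
  freq (g ∘ (inside ∷_)) U  ≡⟨ sym (freq-inside g U) ⟩
  freq g (inside ∷ U)       ∎
  where
  open ≡-Reasoning
  tail~ : ∀ w → marginal S (f ∘ (inside ∷_)) w ≡ marginal S (g ∘ (inside ∷_)) w
  tail~ w = trans (sym (marginal-inside S f w inside)) (trans (f~g (inside ∷ w)) (marginal-inside S g w inside))
marginal⇒freq (outside ∷ S) (outside ∷ U) f g U⊆S f~g = begin
  freq f (outside ∷ U)  ≡⟨ freq-outside f U ⟩
  freq (sum-head f) U   ≡⟨ marginal⇒freq S U _ _ U⊆S tail~ ⟩
  freq (sum-head g) U   ≡⟨ sym (freq-outside g U) ⟩
  freq g (outside ∷ U)  ∎
  where
  open ≡-Reasoning
  tail~ : ∀ w → marginal S (sum-head f) w ≡ marginal S (sum-head g) w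
  tail~ w = trans (sym (marginal-outside S f w)) (trans (f~g (outside ∷ w)) (marginal-outside S g w))

-- Inclusion–exclusion: the frequencies of the subsets of N determine the
-- distribution of z ∩ N.
freq⇒marginal : ∀ N (f g : Subset n → ℚ) → (∀ U → U ⊆ᵇ N ≡ true → freq f U ≡ freq g U) →
  ∀ w → marginal N f w ≡ marginal N g w
freq⇒marginal [] f g f~g [] = begin
  marginal [] f [] ≡⟨ marginal-[] f ⟩
  f []             ≡⟨ sym (freq-[] f) ⟩
  freq f []        ≡⟨ f~g [] refl ⟩
  freq g []        ≡⟨ freq-[] g ⟩
  g []             ≡⟨ sym (marginal-[] g) ⟩
  marginal [] g [] ∎
  where open ≡-Reasoning
freq⇒marginal (inside ∷ N) f g f~g (b ∷ w) = begin
  marginal (inside ∷ N) f (b ∷ w)  ≡⟨ marginal-inside N f w b ⟩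
  marginal N (f ∘ (b ∷_)) w        ≡⟨ freq⇒marginal N _ _ (tail~ b) w ⟩
  marginal N (g ∘ (b ∷_)) w        ≡⟨ sym (marginal-inside N g w b) ⟩
  marginal (inside ∷ N) g (b ∷ w)  ∎
  where
  open ≡-Reasoning
  freq₁~ : ∀ U → U ⊆ᵇ N ≡ true → freq (f ∘ (inside ∷_)) U ≡ freq (g ∘ (inside ∷_)) U
  freq₁~ U U⊆N = trans (sym (freq-inside f U)) (trans (f~g (inside ∷ U) U⊆N) (freq-inside g U))
  tail~ : ∀ b U → U ⊆ᵇ N ≡ true → freq (f ∘ (b ∷_)) U ≡ freq (g ∘ (b ∷_)) U
  tail~ inside  = freq₁~
  tail~ outside U U⊆N = ∙-cancelʳ Q.+-0-group (freq (f ∘ (inside ∷_)) U) _ _ (begin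
    freq (f ∘ (outside ∷_)) U + freq (f ∘ (inside ∷_)) U  ≡⟨ sym (freq-+ (f ∘ (outside ∷_)) _ U) ⟩
    freq (sum-head f) U                                   ≡⟨ sym (freq-outside f U) ⟩
    freq f (outside ∷ U)                                  ≡⟨ f~g (outside ∷ U) U⊆N ⟩
    freq g (outside ∷ U)                                  ≡⟨ freq-outside g U ⟩
    freq (sum-head g) U                                   ≡⟨ freq-+ (g ∘ (outside ∷_)) _ U ⟩
    freq (g ∘ (outside ∷_)) U + freq (g ∘ (inside ∷_)) U  ≡⟨ cong (freq (g ∘ (outside ∷_)) U +_) (sym (freq₁~ U U⊆N)) ⟩
    freq (g ∘ (outside ∷_)) U + freq (f ∘ (inside ∷_)) U  ∎)
freq⇒marginal (outside ∷ N) f g f~g (inside ∷ w) =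
  trans (marginal-outside-∉ N f w) (sym (marginal-outside-∉ N g w))
freq⇒marginal (outside ∷ N) f g f~g (outside ∷ w) = begin
  marginal (outside ∷ N) f (outside ∷ w)  ≡⟨ marginal-outside N f w ⟩
  marginal N (sum-head f) w               ≡⟨ freq⇒marginal N _ _ tail~ w ⟩
  marginal N (sum-head g) w               ≡⟨ sym (marginal-outside N g w) ⟩
  marginal (outside ∷ N) g (outside ∷ w)  ∎
  where
  open ≡-Reasoning
  tail~ : ∀ U → U ⊆ᵇ N ≡ true → freq (sum-head f) U ≡ freq (sum-head g) U
  tail~ U U⊆N = trans (sym (freq-outside f U)) (trans (f~g (outside ∷ U) U⊆N) (freq-outside g U))

-- Gluing along a common marginal

marginal-≡0⇒≡0 : ∀ S (f : Subset n → ℚ) → (∀ z → 0ℚ ℚ.≤ f z) →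
  ∀ w → marginal S f (w ∩ S) ≡ 0ℚ → f w ≡ 0ℚ
marginal-≡0⇒≡0 {n} S f f≥0 w marg≡0
  with Σpts-nonneg-≡0 n _ (λ z → if-nonneg (does (≡-dec BoolP._≟_ (z ∩ S) (w ∩ S))) (f≥0 z)) marg≡0 w
... | fw≡0 rewrite dec-true (≡-dec BoolP._≟_ (w ∩ S) (w ∩ S)) refl = fw≡0

marginal-outside-supported : ∀ {X} S (f : Subset (suc n) → ℚ) → SupportedWithin (outside ∷ X) f →
  ∀ w → marginal (outside ∷ S) f (outside ∷ w) ≡ marginal S (f ∘ (outside ∷_)) w
marginal-outside-supported S f supp w = begin
  marginal (outside ∷ S) f (outside ∷ w)
    ≡⟨ marginal-outside-split S f w ⟩
  marginal S (f ∘ (outside ∷_)) w + marginal S (f ∘ (inside ∷_)) w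
    ≡⟨ cong (marginal S (f ∘ (outside ∷_)) w +_) (marginal-zero S _ (supported-outside _ f supp) w) ⟩
  marginal S (f ∘ (outside ∷_)) w + 0ℚ
    ≡⟨ Q.+-identityʳ _ ⟩
  marginal S (f ∘ (outside ∷_)) w ∎
  where open ≡-Reasoning

Σ⊆ : Subset n → (Subset n → ℚ) → ℚ
Σ⊆ {n} D h = Σpts n (λ d → if d ⊆ᵇ D then h d else 0ℚ)

module _ {n} (D : Subset n) (h : Subset (suc n) → ℚ) where

  Σ⊆-outside : Σ⊆ (outside ∷ D) h ≡ Σ⊆ D (h ∘ (outside ∷_))
  Σ⊆-outside = trans (Σpts-split n _) (trans (cong (Σ⊆ D (h ∘ (outside ∷_)) +_) (Σpts-0 n)) (Q.+-identityʳ _))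

  Σ⊆-inside : Σ⊆ (inside ∷ D) h ≡ Σ⊆ D (h ∘ (outside ∷_)) + Σ⊆ D (h ∘ (inside ∷_))
  Σ⊆-inside = Σpts-split n _

Σ⊆-[] : ∀ (h : Subset 0 → ℚ) → Σ⊆ [] h ≡ h []
Σ⊆-[] h = Q.+-identityʳ _

Σ⊆-cong : ∀ D {g h : Subset n → ℚ} → (∀ z → g z ≡ h z) → Σ⊆ D g ≡ Σ⊆ D h
Σ⊆-cong {n} D g≗h = Σpts-cong n (λ z → cong (λ x → if z ⊆ᵇ D then x else 0ℚ) (g≗h z))

Σ⊆-+ : ∀ D (g h : Subset n → ℚ) → Σ⊆ D (λ z → g z + h z) ≡ Σ⊆ D g + Σ⊆ D h
Σ⊆-+ {n} D g h = trans (Σpts-cong n (λ z → if-+ (z ⊆ᵇ D))) (Σpts-+ n _ _)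

Σ⊆-≡0⇒≡0 : ∀ D (h : Subset n → ℚ) → (∀ z → 0ℚ ℚ.≤ h z) → Σ⊆ D h ≡ 0ℚ →
  ∀ d → d ⊆ᵇ D ≡ true → h d ≡ 0ℚ
Σ⊆-≡0⇒≡0 {n} D h h≥0 Σ≡0 d d⊆D
  with Σpts-nonneg-≡0 n _ (λ z → if-nonneg (z ⊆ᵇ D) (h≥0 z)) Σ≡0 d
... | hd≡0 rewrite d⊆D = hd≡0

Σ⊆-marginal : ∀ (D N : Subset n) (p : Subset n → ℚ) m → D ⊆ᵇ ∁ N ≡ true → m ⊆ᵇ N ≡ true →
  Σ⊆ D (λ d → marginal (D ∪ N) p (d ∪ m)) ≡ marginal N p m
Σ⊆-marginal [] [] p [] _ _ = Σ⊆-[] (λ d → marginal [] p (d ∪ []))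
Σ⊆-marginal (outside ∷ D) (outside ∷ N) p (outside ∷ m) D#N m⊆N = begin
  Σ⊆ (outside ∷ D) (λ d → marginal (outside ∷ D ∪ N) p (d ∪ (outside ∷ m)))
    ≡⟨ Σ⊆-outside D _ ⟩
  Σ⊆ D (λ d → marginal (outside ∷ D ∪ N) p (outside ∷ d ∪ m))
    ≡⟨ Σ⊆-cong D (λ d → marginal-outside-split (D ∪ N) p (d ∪ m)) ⟩
  Σ⊆ D (λ d → marginal (D ∪ N) (p ∘ (outside ∷_)) (d ∪ m) + marginal (D ∪ N) (p ∘ (inside ∷_)) (d ∪ m))
    ≡⟨ Σ⊆-+ D _ _ ⟩
  Σ⊆ D (λ d → marginal (D ∪ N) (p ∘ (outside ∷_)) (d ∪ m)) + Σ⊆ D (λ d → marginal (D ∪ N) (p ∘ (inside ∷_)) (d ∪ m))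
    ≡⟨ cong₂ _+_ (Σ⊆-marginal D N _ m D#N m⊆N) (Σ⊆-marginal D N _ m D#N m⊆N) ⟩
  marginal N (p ∘ (outside ∷_)) m + marginal N (p ∘ (inside ∷_)) m
    ≡⟨ sym (marginal-outside-split N p m) ⟩
  marginal (outside ∷ N) p (outside ∷ m) ∎
  where open ≡-Reasoning
Σ⊆-marginal (inside ∷ D) (outside ∷ N) p (outside ∷ m) D#N m⊆N = begin
  Σ⊆ (inside ∷ D) (λ d → marginal (inside ∷ D ∪ N) p (d ∪ (outside ∷ m)))
    ≡⟨ Σ⊆-inside D _ ⟩
  Σ⊆ D (λ d → marginal (inside ∷ D ∪ N) p (outside ∷ d ∪ m)) + Σ⊆ D (λ d → marginal (inside ∷ D ∪ N) p (inside ∷ d ∪ m))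
    ≡⟨ cong₂ _+_ (Σ⊆-cong D (λ d → marginal-inside (D ∪ N) p (d ∪ m) outside))
                 (Σ⊆-cong D (λ d → marginal-inside (D ∪ N) p (d ∪ m) inside)) ⟩
  Σ⊆ D (λ d → marginal (D ∪ N) (p ∘ (outside ∷_)) (d ∪ m)) + Σ⊆ D (λ d → marginal (D ∪ N) (p ∘ (inside ∷_)) (d ∪ m))
    ≡⟨ cong₂ _+_ (Σ⊆-marginal D N _ m D#N m⊆N) (Σ⊆-marginal D N _ m D#N m⊆N) ⟩
  marginal N (p ∘ (outside ∷_)) m + marginal N (p ∘ (inside ∷_)) m
    ≡⟨ sym (marginal-outside-split N p m) ⟩
  marginal (outside ∷ N) p (outside ∷ m) ∎
  where open ≡-Reasoning
Σ⊆-marginal (outside ∷ D) (inside ∷ N) p (b ∷ m) D#N m⊆N = begin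
  Σ⊆ (outside ∷ D) (λ d → marginal (inside ∷ D ∪ N) p (d ∪ (b ∷ m)))
    ≡⟨ Σ⊆-outside D _ ⟩
  Σ⊆ D (λ d → marginal (inside ∷ D ∪ N) p (b ∷ d ∪ m))
    ≡⟨ Σ⊆-cong D (λ d → marginal-inside (D ∪ N) p (d ∪ m) b) ⟩
  Σ⊆ D (λ d → marginal (D ∪ N) (p ∘ (b ∷_)) (d ∪ m))
    ≡⟨ Σ⊆-marginal D N _ m D#N (tail-⊆ᵇ b m⊆N) ⟩
  marginal N (p ∘ (b ∷_)) m
    ≡⟨ sym (marginal-inside N p m b) ⟩
  marginal (inside ∷ N) p (b ∷ m) ∎
  where
  open ≡-Reasoning
  tail-⊆ᵇ : ∀ b → (b ∷ m) ⊆ᵇ (inside ∷ N) ≡ true → m ⊆ᵇ N ≡ true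
  tail-⊆ᵇ outside m⊆N = m⊆N
  tail-⊆ᵇ inside  m⊆N = m⊆N
Σ⊆-marginal (inside ∷ D) (inside ∷ N) p (_ ∷ m) () _
Σ⊆-marginal (_ ∷ D) (outside ∷ N) p (inside ∷ m) _ ()

product-glue : (X D N : Subset n) (f c₁ c₂ : Subset n → ℚ) → Subset n → ℚ
product-glue X D N f c₁ c₂ z =
  if z ⊆ᵇ X ∪ D then f (z ∩ X) * c₁ (z ∩ (D ∪ N)) * c₂ (z ∩ N) else 0ℚ

marginal-product-glue-X : ∀ (X D N : Subset n) (f c₁ c₂ : Subset n → ℚ) w →
  w ⊆ᵇ X ≡ true → D ⊆ᵇ ∁ X ≡ true → N ⊆ᵇ X ≡ true →
  marginal X (product-glue X D N f c₁ c₂) w ≡ (f w * c₂ (w ∩ N)) * Σ⊆ D (λ d → c₁ (d ∪ (w ∩ N)))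
marginal-product-glue-X [] [] [] f c₁ c₂ [] _ _ _ =
  trans (marginal-[] (product-glue [] [] [] f c₁ c₂))
        (solve 3 (λ a b c → a :* b :* c := (a :* c) :* (b :+ con 0ℚ)) refl (f []) (c₁ []) (c₂ []))
marginal-product-glue-X (outside ∷ X) (outside ∷ D) (outside ∷ N) f c₁ c₂ (outside ∷ w) w⊆X D#X N⊆X =
  trans (marginal-outside-split X _ w)
    (trans (cong₂ _+_
             (marginal-product-glue-X X D N (f ∘ (outside ∷_)) (c₁ ∘ (outside ∷_)) (c₂ ∘ (outside ∷_)) w w⊆X D#X N⊆X)
             (marginal-zero X _ (λ _ → refl) w))
      (trans (Q.+-identityʳ _) (cong (f (outside ∷ w) * c₂ (outside ∷ (w ∩ N)) *_) (sym (Σ⊆-outside D _)))))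
marginal-product-glue-X (outside ∷ X) (inside ∷ D) (outside ∷ N) f c₁ c₂ (outside ∷ w) w⊆X D#X N⊆X =
  trans (marginal-outside-split X _ w)
    (trans (cong₂ _+_
             (marginal-product-glue-X X D N (f ∘ (outside ∷_)) (c₁ ∘ (outside ∷_)) (c₂ ∘ (outside ∷_)) w w⊆X D#X N⊆X)
             (marginal-product-glue-X X D N (f ∘ (outside ∷_)) (c₁ ∘ (inside ∷_)) (c₂ ∘ (outside ∷_)) w w⊆X D#X N⊆X))
      (trans (sym (Q.*-distribˡ-+ (f (outside ∷ w) * c₂ (outside ∷ (w ∩ N))) _ _))
        (cong (f (outside ∷ w) * c₂ (outside ∷ (w ∩ N)) *_) (sym (Σ⊆-inside D _)))))
marginal-product-glue-X (inside ∷ X) (outside ∷ D) (outside ∷ N) f c₁ c₂ (outside ∷ w) w⊆X D#X N⊆X =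
  trans (marginal-inside X _ w outside)
    (trans (marginal-product-glue-X X D N (f ∘ (outside ∷_)) (c₁ ∘ (outside ∷_)) (c₂ ∘ (outside ∷_)) w w⊆X D#X N⊆X)
      (cong (f (outside ∷ w) * c₂ (outside ∷ (w ∩ N)) *_) (sym (Σ⊆-outside D _))))
marginal-product-glue-X (inside ∷ X) (outside ∷ D) (outside ∷ N) f c₁ c₂ (inside ∷ w) w⊆X D#X N⊆X =
  trans (marginal-inside X _ w inside)
    (trans (marginal-product-glue-X X D N (f ∘ (inside ∷_)) (c₁ ∘ (outside ∷_)) (c₂ ∘ (outside ∷_)) w w⊆X D#X N⊆X)
      (cong (f (inside ∷ w) * c₂ (outside ∷ (w ∩ N)) *_) (sym (Σ⊆-outside D _))))
marginal-product-glue-X (inside ∷ X) (outside ∷ D) (inside ∷ N) f c₁ c₂ (outside ∷ w) w⊆X D#X N⊆X =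
  trans (marginal-inside X _ w outside)
    (trans (marginal-product-glue-X X D N (f ∘ (outside ∷_)) (c₁ ∘ (outside ∷_)) (c₂ ∘ (outside ∷_)) w w⊆X D#X N⊆X)
      (cong (f (outside ∷ w) * c₂ (outside ∷ (w ∩ N)) *_) (sym (Σ⊆-outside D _))))
marginal-product-glue-X (inside ∷ X) (outside ∷ D) (inside ∷ N) f c₁ c₂ (inside ∷ w) w⊆X D#X N⊆X =
  trans (marginal-inside X _ w inside)
    (trans (marginal-product-glue-X X D N (f ∘ (inside ∷_)) (c₁ ∘ (inside ∷_)) (c₂ ∘ (inside ∷_)) w w⊆X D#X N⊆X)
      (cong (f (inside ∷ w) * c₂ (inside ∷ (w ∩ N)) *_) (sym (Σ⊆-outside D _))))
marginal-product-glue-X (outside ∷ X) _ _ f c₁ c₂ (inside ∷ w) () _ _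
marginal-product-glue-X (inside ∷ X) (inside ∷ D) _ f c₁ c₂ (_ ∷ w) _ () _
marginal-product-glue-X (outside ∷ X) _ (inside ∷ N) f c₁ c₂ (_ ∷ w) _ _ ()

marginal-product-glue-DN : ∀ (X D N : Subset n) (f c₁ c₂ : Subset n → ℚ) y → SupportedWithin X f →
  D ⊆ᵇ ∁ X ≡ true → N ⊆ᵇ X ≡ true → y ⊆ᵇ D ∪ N ≡ true →
  marginal (D ∪ N) (product-glue X D N f c₁ c₂) y ≡ (c₁ y * c₂ (y ∩ N)) * marginal N f (y ∩ N)
marginal-product-glue-DN [] [] [] f c₁ c₂ [] _ _ _ _ =
  trans (marginal-[] (product-glue [] [] [] f c₁ c₂))
    (trans (solve 3 (λ a b c → a :* b :* c := (b :* c) :* a) refl (f []) (c₁ []) (c₂ []))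
      (cong (c₁ [] * c₂ [] *_) (sym (marginal-[] f))))
marginal-product-glue-DN (outside ∷ X) (outside ∷ D) (outside ∷ N) f c₁ c₂ (outside ∷ y) supp D#X N⊆X y⊆D∪N =
  trans (marginal-outside-split (D ∪ N) _ y)
    (trans (cong₂ _+_ (marginal-product-glue-DN X D N (f ∘ (outside ∷_)) (c₁ ∘ (outside ∷_)) (c₂ ∘ (outside ∷_)) y
                         (supported-tail X f outside supp) D#X N⊆X y⊆D∪N)
                      (marginal-zero (D ∪ N) _ (λ _ → refl) y))
      (trans (Q.+-identityʳ _)
        (cong (c₁ (outside ∷ y) * c₂ (outside ∷ (y ∩ N)) *_) (sym (marginal-outside-supported N f supp (y ∩ N))))))
marginal-product-glue-DN (inside ∷ X) (outside ∷ D) (outside ∷ N) f c₁ c₂ (outside ∷ y) supp D#X N⊆X y⊆D∪N =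
  trans (marginal-outside-split (D ∪ N) _ y)
    (trans (cong₂ _+_ (marginal-product-glue-DN X D N (f ∘ (outside ∷_)) (c₁ ∘ (outside ∷_)) (c₂ ∘ (outside ∷_)) y
                         (supported-tail X f outside supp) D#X N⊆X y⊆D∪N)
                      (marginal-product-glue-DN X D N (f ∘ (inside ∷_)) (c₁ ∘ (outside ∷_)) (c₂ ∘ (outside ∷_)) y
                         (supported-tail X f inside supp) D#X N⊆X y⊆D∪N))
      (trans (sym (Q.*-distribˡ-+ (c₁ (outside ∷ y) * c₂ (outside ∷ (y ∩ N))) _ _))
        (cong (c₁ (outside ∷ y) * c₂ (outside ∷ (y ∩ N)) *_) (sym (marginal-outside-split N f (y ∩ N))))))
marginal-product-glue-DN (inside ∷ X) (outside ∷ D) (inside ∷ N) f c₁ c₂ (outside ∷ y) supp D#X N⊆X y⊆D∪N =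
  trans (marginal-inside (D ∪ N) _ y outside)
    (trans (marginal-product-glue-DN X D N (f ∘ (outside ∷_)) (c₁ ∘ (outside ∷_)) (c₂ ∘ (outside ∷_)) y
              (supported-tail X f outside supp) D#X N⊆X y⊆D∪N)
      (cong (c₁ (outside ∷ y) * c₂ (outside ∷ (y ∩ N)) *_) (sym (marginal-inside N f (y ∩ N) outside))))
marginal-product-glue-DN (inside ∷ X) (outside ∷ D) (inside ∷ N) f c₁ c₂ (inside ∷ y) supp D#X N⊆X y⊆D∪N =
  trans (marginal-inside (D ∪ N) _ y inside)
    (trans (marginal-product-glue-DN X D N (f ∘ (inside ∷_)) (c₁ ∘ (inside ∷_)) (c₂ ∘ (inside ∷_)) y
              (supported-tail X f inside supp) D#X N⊆X y⊆D∪N)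
      (cong (c₁ (inside ∷ y) * c₂ (inside ∷ (y ∩ N)) *_) (sym (marginal-inside N f (y ∩ N) inside))))
marginal-product-glue-DN (outside ∷ X) (inside ∷ D) (outside ∷ N) f c₁ c₂ (outside ∷ y) supp D#X N⊆X y⊆D∪N =
  trans (marginal-inside (D ∪ N) _ y outside)
    (trans (marginal-product-glue-DN X D N (f ∘ (outside ∷_)) (c₁ ∘ (outside ∷_)) (c₂ ∘ (outside ∷_)) y
              (supported-tail X f outside supp) D#X N⊆X y⊆D∪N)
      (cong (c₁ (outside ∷ y) * c₂ (outside ∷ (y ∩ N)) *_) (sym (marginal-outside-supported N f supp (y ∩ N)))))
marginal-product-glue-DN (outside ∷ X) (inside ∷ D) (outside ∷ N) f c₁ c₂ (inside ∷ y) supp D#X N⊆X y⊆D∪N =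
  trans (marginal-inside (D ∪ N) _ y inside)
    (trans (marginal-product-glue-DN X D N (f ∘ (outside ∷_)) (c₁ ∘ (inside ∷_)) (c₂ ∘ (outside ∷_)) y
              (supported-tail X f outside supp) D#X N⊆X y⊆D∪N)
      (cong (c₁ (inside ∷ y) * c₂ (outside ∷ (y ∩ N)) *_) (sym (marginal-outside-supported N f supp (y ∩ N)))))
marginal-product-glue-DN (_ ∷ X) (outside ∷ D) (outside ∷ N) f c₁ c₂ (inside ∷ y) _ _ _ ()
marginal-product-glue-DN (inside ∷ X) (inside ∷ D) _ f c₁ c₂ (_ ∷ y) _ () _ _
marginal-product-glue-DN (outside ∷ X) _ (inside ∷ N) f c₁ c₂ (_ ∷ y) _ _ () _

-- A total reciprocal, with the junk value inv₀ 0ℚ = 0ℚ.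
inv₀ : ℚ → ℚ
inv₀ (mkℚ (ℤ.+ 0) _ _)         = 0ℚ
inv₀ p@(mkℚ ℤ.+[1+ _ ] _ _)    = 1/ p
inv₀ p@(mkℚ ℤ.-[1+ _ ] _ _)    = 1/ p

inv₀-nonneg : ∀ p → 0ℚ ℚ.≤ p → 0ℚ ℚ.≤ inv₀ p
inv₀-nonneg (mkℚ (ℤ.+ 0) _ _)      _   = Q.≤-refl
inv₀-nonneg p@(mkℚ ℤ.+[1+ _ ] _ _) _   = Q.nonNegative⁻¹ (1/ p)
inv₀-nonneg p@(mkℚ ℤ.-[1+ _ ] _ _) p≥0 = ⊥-elim (Q.<-irrefl refl (Q.≤-<-trans p≥0 (Q.negative⁻¹ p)))

inv₀-inverseˡ : ∀ p → p ≢ 0ℚ → inv₀ p * p ≡ 1ℚ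
inv₀-inverseˡ (mkℚ (ℤ.+ 0) _ _)      p≢0 = ⊥-elim (p≢0 (Q.↥p≡0⇒p≡0 _ refl))
inv₀-inverseˡ p@(mkℚ ℤ.+[1+ _ ] _ _) _   = Q.*-inverseˡ p
inv₀-inverseˡ p@(mkℚ ℤ.-[1+ _ ] _ _) _   = Q.*-inverseˡ p

*-inv₀-cancelʳ : ∀ a p → (p ≡ 0ℚ → a ≡ 0ℚ) → a * inv₀ p * p ≡ a
*-inv₀-cancelʳ a p a≡0 with p Q.≟ 0ℚ
... | yes refl = trans (Q.*-zeroʳ (a * inv₀ 0ℚ)) (sym (a≡0 refl))
... | no  p≢0  = trans (Q.*-assoc a _ p) (trans (cong (a *_) (inv₀-inverseˡ p p≢0)) (Q.*-identityʳ a))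

-- f on X and p on D ∪ N, glued into the point function on X ∪ D under which
-- the coordinates in X and those in D are conditionally independent given N:
--   f(z ∩ X) · p_{D ∪ N}(z ∩ (D ∪ N)) / p_N(z ∩ N).
glue : (X D N : Subset n) (f p : Subset n → ℚ) → Subset n → ℚ
glue X D N f p = product-glue X D N f (marginal (D ∪ N) p) (inv₀ ∘ marginal N p)

module _ {n} (X D N : Subset n) (f p : Subset n → ℚ) where

  glue-nonneg : (∀ z → 0ℚ ℚ.≤ f z) → (∀ z → 0ℚ ℚ.≤ p z) → ∀ z → 0ℚ ℚ.≤ glue X D N f p z
  glue-nonneg f≥0 p≥0 z = if-nonneg (z ⊆ᵇ X ∪ D)
    (*-nonneg (*-nonneg (f≥0 _) (marginal-nonneg (D ∪ N) p p≥0 _))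
              (inv₀-nonneg _ (marginal-nonneg N p p≥0 _)))

  glue-supported : SupportedWithin (X ∪ D) (glue X D N f p)
  glue-supported z z⊈X∪D rewrite z⊈X∪D = refl

  module _ (D#X : ∀ {t} → t ∈ D → t ∉ X) (N⊆X : N ⊆ X)
           (f~p : ∀ m → marginal N f m ≡ marginal N p m) where

    private
      D#Xᵇ : D ⊆ᵇ ∁ X ≡ true
      D#Xᵇ = disjoint⇒⊆ᵇ∁ D X D#X

      N⊆Xᵇ : N ⊆ᵇ X ≡ true
      N⊆Xᵇ = ⊆⇒⊆ᵇ N X N⊆X

      D#Nᵇ : D ⊆ᵇ ∁ N ≡ true
      D#Nᵇ = disjoint⇒⊆ᵇ∁ D N (λ t∈D t∈N → D#X t∈D (N⊆X t∈N))

    glue-marginal-X : SupportedWithin X f → (∀ z → 0ℚ ℚ.≤ f z) →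
      ∀ w → marginal X (glue X D N f p) w ≡ marginal X f w
    glue-marginal-X supp f≥0 w with w ⊆ᵇ X in w⊆X
    ... | false = trans (marginal-⊈ X _ w w⊆X) (sym (marginal-⊈ X f w w⊆X))
    ... | true  = begin
      marginal X (glue X D N f p) w
        ≡⟨ marginal-product-glue-X X D N f (marginal (D ∪ N) p) (inv₀ ∘ marginal N p) w w⊆X D#Xᵇ N⊆Xᵇ ⟩
      f w * inv₀ pN * Σ⊆ D (λ d → marginal (D ∪ N) p (d ∪ (w ∩ N)))
        ≡⟨ cong (f w * inv₀ pN *_) (Σ⊆-marginal D N p (w ∩ N) D#Nᵇ (∩⊆ᵇʳ w N)) ⟩
      f w * inv₀ pN * pN
        ≡⟨ *-inv₀-cancelʳ (f w) pN (λ pN≡0 → marginal-≡0⇒≡0 N f f≥0 w (trans (f~p (w ∩ N)) pN≡0)) ⟩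
      f w
        ≡⟨ sym (marginal-supported X f supp w w⊆X) ⟩
      marginal X f w ∎
      where
      open ≡-Reasoning
      pN : ℚ
      pN = marginal N p (w ∩ N)

    glue-marginal-DN : SupportedWithin X f → (∀ z → 0ℚ ℚ.≤ p z) →
      ∀ y → marginal (D ∪ N) (glue X D N f p) y ≡ marginal (D ∪ N) p y
    glue-marginal-DN supp p≥0 y with y ⊆ᵇ D ∪ N in y⊆D∪N
    ... | false = trans (marginal-⊈ (D ∪ N) _ y y⊆D∪N) (sym (marginal-⊈ (D ∪ N) p y y⊆D∪N))
    ... | true  = begin
      marginal (D ∪ N) (glue X D N f p) y
        ≡⟨ marginal-product-glue-DN X D N f (marginal (D ∪ N) p) (inv₀ ∘ marginal N p) y supp D#Xᵇ N⊆Xᵇ y⊆D∪N ⟩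
      pDN * inv₀ pN * marginal N f (y ∩ N)
        ≡⟨ cong (pDN * inv₀ pN *_) (f~p (y ∩ N)) ⟩
      pDN * inv₀ pN * pN
        ≡⟨ *-inv₀-cancelʳ pDN pN pDN≡0 ⟩
      pDN ∎
      where
      open ≡-Reasoning
      pN pDN : ℚ
      pN  = marginal N p (y ∩ N)
      pDN = marginal (D ∪ N) p y
      pDN≡0 : pN ≡ 0ℚ → pDN ≡ 0ℚ
      pDN≡0 pN≡0 = trans (cong (marginal (D ∪ N) p) (sym (∩-∪-recompose y D N y⊆D∪N)))
        (Σ⊆-≡0⇒≡0 D (λ d → marginal (D ∪ N) p (d ∪ (y ∩ N))) (λ _ → marginal-nonneg (D ∪ N) p p≥0 _)
          (trans (Σ⊆-marginal D N p (y ∩ N) D#Nᵇ (∩⊆ᵇʳ y N)) pN≡0) (y ∩ D) (∩⊆ᵇʳ y D))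

-- Sufficiency: extending component by component

-- For y ∉ C, comp y is the connected component of y in G − C and nb y its
-- neighbourhood in C; for y ∈ C the values are irrelevant.
record ComponentsOutside {K} (F : Family K) (C : Subset K) : Set where
  field
    comp nb      : Fin K → Subset K
    comp-self    : ∀ {y} → y ∉ C → y ∈ comp y
    comp-outside : ∀ {y t} → t ∈ comp y → t ∉ C
    comp-merge   : ∀ {y y' t} → t ∈ comp y → t ∈ comp y' → y ∈ comp y'
    nb-inside    : ∀ y → nb y ⊆ C
    nb-frequent  : ∀ {y} → y ∉ C → F (nb y)
    confined     : ∀ {U} → F U → ∀ {y t} → y ∉ C → t ∈ U → t ∈ comp y → U ⊆ comp y ∪ nb y

-- The distribution q on C is extended one component at a time: the next
-- component D is glued to the current extension on X, conditionally
-- independent of X given its neighbourhood N ⊆ X.  On N the current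
-- extension already has the frequencies θ, hence the marginal of any
-- distribution satisfying θ, and every itemset of F meeting D lies in D ∪ N.
module _ {K} {F : Family K} (anti : Antimonotonic F) {C : Subset K} (cs : ComponentsOutside F C) where

  open ComponentsOutside cs

  ComponentClosed : Subset K → Set
  ComponentClosed X = ∀ {t y} → t ∈ X → t ∈ comp y → y ∈ X

  module _ (θ : Subset K → ℚ) (p : Dist K) (p⊨θ : Satisfies F p θ)
           (q : Dist K) (q-on-C : SupportedOn C q) (q⊨θ : ∀ U → F U → U ⊆ C → Freq q U ≡ θ U) where

    record PartialExtension (X : Subset K) : Set where
      field
        f         : Subset K → ℚ
        supported : SupportedWithin X f
        f≥0       : ∀ z → 0ℚ ℚ.≤ f z
        f⊨θ       : ∀ U → F U → U ⊆ X → freq f U ≡ θ U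
        extends-q : ∀ w → marginal C f w ≡ marginal C (prob q) w
        C⊆X       : C ⊆ X
        closed    : ComponentClosed X

    q-supported : SupportedWithin C (prob q)
    q-supported z z⊈C = q-on-C z λ z∩C≡z →
      case trans (sym (⊆⇒⊆ᵇ z C (subst (_⊆ C) z∩C≡z (p∩q⊆q z C)))) z⊈C of λ ()

    initial-extension : PartialExtension C
    initial-extension = record
      { f         = prob q
      ; supported = q-supported
      ; f≥0       = nonneg q
      ; f⊨θ       = q⊨θ
      ; extends-q = λ _ → refl
      ; C⊆X       = id
      ; closed    = λ t∈C t∈D → ⊥-elim (comp-outside t∈D t∈C)
      }

    add-component : ∀ {X} → PartialExtension X → ∀ {y} → y ∉ X → PartialExtension (X ∪ comp y)
    add-component {X} ext {y} y∉X = record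
      { f         = f'
      ; supported = glue-supported X D N f (prob p)
      ; f≥0       = glue-nonneg X D N f (prob p) f≥0 (nonneg p)
      ; f⊨θ       = f'⊨θ
      ; extends-q = λ w → trans (freq⇒marginal C f' f (λ U U⊆C →
                      marginal⇒freq X U f' f (⊆⇒⊆ᵇ U X (C⊆X ∘ ⊆ᵇ⇒⊆ U C U⊆C)) agree-X) w) (extends-q w)
      ; C⊆X       = p⊆p∪q D ∘ C⊆X
      ; closed    = closed'
      }
      where
      open PartialExtension ext
      D N : Subset K
      D = comp y
      N = nb y
      y∉C : y ∉ C
      y∉C = y∉X ∘ C⊆X
      N⊆X : N ⊆ X
      N⊆X = C⊆X ∘ nb-inside y
      D#X : ∀ {t} → t ∈ D → t ∉ X
      D#X t∈D t∈X = y∉X (closed t∈X t∈D)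
      f~p : ∀ m → marginal N f m ≡ marginal N (prob p) m
      f~p = freq⇒marginal N f (prob p) λ U U⊆N →
        let FU = anti N U (⊆ᵇ⇒⊆ U N U⊆N) (nb-frequent y∉C) in
        trans (f⊨θ U FU (N⊆X ∘ ⊆ᵇ⇒⊆ U N U⊆N)) (sym (p⊨θ U FU))
      f' : Subset K → ℚ
      f' = glue X D N f (prob p)
      agree-X : ∀ w → marginal X f' w ≡ marginal X f w
      agree-X = glue-marginal-X X D N f (prob p) D#X N⊆X f~p supported f≥0
      agree-DN : ∀ w → marginal (D ∪ N) f' w ≡ marginal (D ∪ N) (prob p) w
      agree-DN = glue-marginal-DN X D N f (prob p) D#X N⊆X f~p supported (nonneg p)
      f'⊨θ : ∀ U → F U → U ⊆ X ∪ D → freq f' U ≡ θ U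
      f'⊨θ U FU U⊆X∪D with U ⊆ᵇ X in U⊆X
      ... | true = trans (marginal⇒freq X U f' f U⊆X agree-X) (f⊨θ U FU (⊆ᵇ⇒⊆ U X U⊆X))
      ... | false with ⊈ᵇ⇒witness U X U⊆X
      ... | t , t∈U , t∉X with x∈p∪q⁻ X D (U⊆X∪D t∈U)
      ... | inj₁ t∈X = ⊥-elim (t∉X t∈X)
      ... | inj₂ t∈D = trans (marginal⇒freq (D ∪ N) U f' (prob p)
                         (⊆⇒⊆ᵇ U (D ∪ N) (confined FU y∉C t∈U t∈D)) agree-DN) (p⊨θ U FU)
      closed' : ComponentClosed (X ∪ D)
      closed' {t} t∈X∪D t∈D' with x∈p∪q⁻ X D t∈X∪D
      ... | inj₁ t∈X = p⊆p∪q D (closed t∈X t∈D')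
      ... | inj₂ t∈D = q⊆p∪q X D (comp-merge t∈D' t∈D)

    cover-item : ∀ {X} → PartialExtension X → ∀ y →
      Σ (Subset K) λ X' → PartialExtension X' × X ⊆ X' × y ∈ X'
    cover-item {X} ext y with y ∈? X
    ... | yes y∈X = X , ext , id , y∈X
    ... | no  y∉X = X ∪ comp y , add-component ext y∉X , p⊆p∪q (comp y) ,
                    q⊆p∪q X (comp y) (comp-self (y∉X ∘ PartialExtension.C⊆X ext))

    cover-all : ∀ (ys : List (Fin K)) {X} → PartialExtension X →
      Σ (Subset K) λ X' → PartialExtension X' × X ⊆ X' × (∀ {y} → y ∈ₗ ys → y ∈ X')
    cover-all []       ext = _ , ext , id , λ ()
    cover-all (y ∷ ys) ext with cover-item ext y
    ... | X₁ , ext₁ , X⊆X₁ , y∈X₁ with cover-all ys ext₁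
    ... | X₂ , ext₂ , X₁⊆X₂ , ys⊆X₂ = X₂ , ext₂ , X₁⊆X₂ ∘ X⊆X₁ , λ where
      (here refl) → X₁⊆X₂ y∈X₁
      (there y∈ys) → ys⊆X₂ y∈ys

    extension : ∃[ p' ] (Satisfies F p' θ × (∀ z' → z' ⊆ C → Marginal C p' z' ≡ prob q z'))
    extension with cover-all (allFin K) initial-extension
    ... | X , ext , _ , all⊆X = p' , (λ U FU → f⊨θ U FU (λ {t} _ → all⊆X (∈-allFin t))) , extends
      where
      open PartialExtension ext
      total' : Σpts K f ≡ 1ℚ
      total' = begin
        Σpts K f         ≡⟨ freq-∅ f ⟨
        freq f ∅         ≡⟨ marginal⇒freq C ∅ f (prob q) (⊆⇒⊆ᵇ ∅ C ⊥⊆) extends-q ⟩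
        freq (prob q) ∅  ≡⟨ freq-∅ (prob q) ⟩
        Σpts K (prob q)  ≡⟨ total q ⟩
        1ℚ               ∎
        where open ≡-Reasoning
      p' : Dist K
      p' = record { prob = f ; nonneg = f≥0 ; total = total' }
      extends : ∀ z' → z' ⊆ C → Marginal C p' z' ≡ prob q z'
      extends z' z'⊆C = trans (extends-q z') (marginal-supported C (prob q) q-supported z' (⊆⇒⊆ᵇ z' C z'⊆C))

  componentsOutside⇒safe : Safe F C
  componentsOutside⇒safe θ (p , p⊨θ) q q-on-C q⊨θ = extension θ p p⊨θ q q-on-C q⊨θ

¬¬-decidable : ∀ n (P : Fin n → Set) → ¬ ¬ (∀ i → Dec (P i))
¬¬-decidable n P = FinP.sequence (RawMonad.rawApplicative ¬¬-Monad) (λ _ → ¬¬-excluded-middle)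

¬¬-decidable₂ : ∀ n (R : Fin n → Fin n → Set) → ¬ ¬ (∀ a b → Dec (R a b))
¬¬-decidable₂ n R = FinP.sequence (RawMonad.rawApplicative ¬¬-Monad) (λ a → ¬¬-decidable n (R a))

record Comprehension {n} (P : Fin n → Set) : Set where
  field
    set      : Subset n
    sound    : ∀ {i} → i ∈ set → P i
    complete : ∀ {i} → P i → i ∈ set

comprehension : ∀ {n} {P : Fin n → Set} → (∀ i → Dec (P i)) → Comprehension P
comprehension {n} {P} P? = record { set = S ; sound = sound ; complete = complete }
  where
  S : Subset n
  S = tabulate (does ∘ P?)
  sound : ∀ {i} → i ∈ S → P i
  sound {i} i∈S with P? i | trans (sym (lookup∘tabulate (λ j → does (P? j)) i)) ([]=⇒lookup i∈S)
  ... | yes Pi | _ = Pi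
  complete : ∀ {i} → P i → i ∈ S
  complete {i} Pi = lookup⇒[]= i S (trans (lookup∘tabulate (λ j → does (P? j)) i) (dec-true (P? i) Pi))

¬¬-decidable-subsets : ∀ n (P : Subset n → Set) → ¬ ¬ (∀ U → Dec (P U))
¬¬-decidable-subsets zero    P ¬dec = ¬¬-excluded-middle λ P[]? → ¬dec λ { [] → P[]? }
¬¬-decidable-subsets (suc n) P ¬dec =
  ¬¬-decidable-subsets n (P ∘ (outside ∷_)) λ P₀? →
  ¬¬-decidable-subsets n (P ∘ (inside ∷_)) λ P₁? →
  ¬dec λ { (outside ∷ U) → P₀? U ; (inside ∷ U) → P₁? U }

-- Necessity: bypasses of safe sets

Ind-⊆ : ∀ {U z : Subset n} → U ⊆ z → Ind U z ≡ 1ℚ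
Ind-⊆ {U = U} {z} U⊆z = cong (λ b → if b then 1ℚ else 0ℚ) (dec-true (U ⊆? z) U⊆z)

Ind-⊈ : ∀ {U z : Subset n} → ¬ U ⊆ z → Ind U z ≡ 0ℚ
Ind-⊈ {U = U} {z} U⊈z = cong (λ b → if b then 1ℚ else 0ℚ) (dec-false (U ⊆? z) U⊈z)

freq-≡⇒⊆-forces : ∀ {A B : Subset n} (f : Subset n → ℚ) → (∀ z → 0ℚ ℚ.≤ f z) → A ⊆ B →
  freq f A ≡ freq f B → ∀ z → A ⊆ z → ¬ B ⊆ z → f z ≡ 0ℚ
freq-≡⇒⊆-forces {n} {A} {B} f f≥0 A⊆B fA≡fB z A⊆z B⊈z =
  trans (sym (Q.*-identityʳ (f z))) (subst (λ d → f z * d ≡ 0ℚ) gap≡1 (Σpts-nonneg-≡0 n _ terms≥0 Σterms≡0 z))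
  where
  gap : Subset n → ℚ
  gap y = Ind A y - Ind B y
  gap≥0 : ∀ y → 0ℚ ℚ.≤ gap y
  gap≥0 y with A ⊆? y | B ⊆? y
  ... | yes _   | yes _   = Q.≤-refl
  ... | yes _   | no  _   = Q.nonNegative⁻¹ 1ℚ
  ... | no  A⊈y | yes B⊆y = ⊥-elim (A⊈y (B⊆y ∘ A⊆B))
  ... | no  _   | no  _   = Q.≤-refl
  gap≡1 : gap z ≡ 1ℚ
  gap≡1 rewrite Ind-⊆ A⊆z | Ind-⊈ B⊈z = refl
  terms≥0 : ∀ y → 0ℚ ℚ.≤ f y * gap y
  terms≥0 y = *-nonneg (f≥0 y) (gap≥0 y)
  Σterms≡0 : Σpts n (λ y → f y * gap y) ≡ 0ℚ
  Σterms≡0 = ∙-cancelʳ Q.+-0-group (freq f B) _ _ (begin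
    Σpts n (λ y → f y * gap y) + freq f B
      ≡⟨ Σpts-+ n _ _ ⟨
    Σpts n (λ y → f y * gap y + f y * Ind B y)
      ≡⟨ Σpts-cong n (λ y → solve 3 (λ x i j → x :* (i :- j) :+ x :* j := x :* i) refl (f y) (Ind A y) (Ind B y)) ⟩
    freq f A
      ≡⟨ fA≡fB ⟩
    freq f B
      ≡⟨ Q.+-identityˡ _ ⟨
    0ℚ + freq f B ∎)
    where
    open ≡-Reasoning

δ : Subset n → Subset n → ℚ
δ w z = if does (≡-dec BoolP._≟_ z w) then 1ℚ else 0ℚ

δ-≢ : ∀ {w z : Subset n} → z ≢ w → δ w z ≡ 0ℚ
δ-≢ {w = w} {z} z≢w = cong (λ b → if b then 1ℚ else 0ℚ) (dec-false (≡-dec BoolP._≟_ z w) z≢w)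

δ-≡ : ∀ (w : Subset n) → δ w w ≡ 1ℚ
δ-≡ w = cong (λ b → if b then 1ℚ else 0ℚ) (dec-true (≡-dec BoolP._≟_ w w) refl)

δ-nonneg : ∀ (w z : Subset n) → 0ℚ ℚ.≤ δ w z
δ-nonneg w z = if-nonneg (does (≡-dec BoolP._≟_ z w)) (Q.nonNegative⁻¹ 1ℚ)

Σpts-δ : ∀ n (w : Subset n) (g : Subset n → ℚ) → Σpts n (λ z → δ w z * g z) ≡ g w
Σpts-δ zero [] g = trans (Q.+-identityʳ _) (Q.*-identityˡ _)
Σpts-δ (suc n) (outside ∷ w) g = begin
  Σpts (suc n) (λ z → δ (outside ∷ w) z * g z)
    ≡⟨ Σpts-split n _ ⟩
  Σpts n (λ z → δ w z * g (outside ∷ z)) + Σpts n (λ z → 0ℚ * g (inside ∷ z))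
    ≡⟨ cong₂ _+_ (Σpts-δ n w (g ∘ (outside ∷_))) (trans (Σpts-cong n (λ z → Q.*-zeroˡ (g (inside ∷ z)))) (Σpts-0 n)) ⟩
  g (outside ∷ w) + 0ℚ
    ≡⟨ Q.+-identityʳ _ ⟩
  g (outside ∷ w) ∎
  where open ≡-Reasoning
Σpts-δ (suc n) (inside ∷ w) g = begin
  Σpts (suc n) (λ z → δ (inside ∷ w) z * g z)
    ≡⟨ Σpts-split n _ ⟩
  Σpts n (λ z → 0ℚ * g (outside ∷ z)) + Σpts n (λ z → δ w z * g (inside ∷ z))
    ≡⟨ cong₂ _+_ (trans (Σpts-cong n (λ z → Q.*-zeroˡ (g (outside ∷ z)))) (Σpts-0 n)) (Σpts-δ n w (g ∘ (inside ∷_))) ⟩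
  0ℚ + g (inside ∷ w)
    ≡⟨ Q.+-identityˡ _ ⟩
  g (inside ∷ w) ∎
  where open ≡-Reasoning

mixture : List (ℚ × Subset n) → Subset n → ℚ
mixture []             z = 0ℚ
mixture ((c , w) ∷ ws) z = c * δ w z + mixture ws z

mixture-mean : List (ℚ × Subset n) → (Subset n → ℚ) → ℚ
mixture-mean []             g = 0ℚ
mixture-mean ((c , w) ∷ ws) g = c * g w + mixture-mean ws g

Σpts-mixture : ∀ n (ws : List (ℚ × Subset n)) (g : Subset n → ℚ) →
  Σpts n (λ z → mixture ws z * g z) ≡ mixture-mean ws g
Σpts-mixture n []             g = trans (Σpts-cong n (λ z → Q.*-zeroˡ (g z))) (Σpts-0 n)
Σpts-mixture n ((c , w) ∷ ws) g = begin
  Σpts n (λ z → (c * δ w z + mixture ws z) * g z)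
    ≡⟨ Σpts-cong n (λ z → solve 4 (λ c d m x → (c :* d :+ m) :* x := c :* (d :* x) :+ m :* x)
                                  refl c (δ w z) (mixture ws z) (g z)) ⟩
  Σpts n (λ z → c * (δ w z * g z) + mixture ws z * g z)
    ≡⟨ Σpts-+ n _ _ ⟩
  Σpts n (λ z → c * (δ w z * g z)) + Σpts n (λ z → mixture ws z * g z)
    ≡⟨ cong₂ _+_ (trans (Σpts-*ˡ n c _) (cong (c *_) (Σpts-δ n w g))) (Σpts-mixture n ws g) ⟩
  c * g w + mixture-mean ws g ∎
  where open ≡-Reasoning

mixture-nonneg : ∀ {ws : List (ℚ × Subset n)} → All (λ cw → 0ℚ ℚ.≤ proj₁ cw) ws → ∀ z → 0ℚ ℚ.≤ mixture ws z
mixture-nonneg []                  z = Q.≤-refl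
mixture-nonneg {ws = (_ , w) ∷ _} (c≥0 ∷ ws≥0) z =
  Q.+-mono-≤ (*-nonneg c≥0 (δ-nonneg w z)) (mixture-nonneg ws≥0 z)

mixture-≡0 : ∀ {ws : List (ℚ × Subset n)} {z} → All (λ cw → z ≢ proj₂ cw) ws → mixture ws z ≡ 0ℚ
mixture-≡0 []                        = refl
mixture-≡0 {ws = (c , _) ∷ _} (z≢w ∷ z≢ws) =
  trans (cong₂ _+_ (trans (cong (c *_) (δ-≢ z≢w)) (Q.*-zeroʳ c)) (mixture-≡0 z≢ws)) (Q.+-identityˡ 0ℚ)

mixtureDist : (ws : List (ℚ × Subset n)) → All (λ cw → 0ℚ ℚ.≤ proj₁ cw) ws →
  mixture-mean ws (λ _ → 1ℚ) ≡ 1ℚ → Dist n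
mixtureDist {n} ws ws≥0 Σws≡1 = record
  { prob   = mixture ws
  ; nonneg = mixture-nonneg ws≥0
  ; total  = trans (Σpts-cong n (λ z → sym (Q.*-identityʳ (mixture ws z)))) (trans (Σpts-mixture n ws _) Σws≡1)
  }

Adj-sym : ∀ {K} (F : Family K) {a b} → Adj F a b → Adj F b a
Adj-sym F {a} {b} (a≢b , Fab) = a≢b ∘ sym , subst F (∪-comm ⁅ a ⁆ ⁅ b ⁆) Fab

∈-pair : ∀ {u v x : Fin n} → x ∈ ⁅ u ⁆ ∪ ⁅ v ⁆ → x ≡ u ⊎ x ≡ v
∈-pair {u = u} {v} {x} x∈uv with x∈p∪q⁻ ⁅ u ⁆ ⁅ v ⁆ x∈uv
... | inj₁ x∈u = inj₁ (x∈⁅y⁆⇒x≡y u x∈u)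
... | inj₂ x∈v = inj₂ (x∈⁅y⁆⇒x≡y v x∈v)

pair-⊆ : ∀ {u v : Fin n} {X} → u ∈ X → v ∈ X → ⁅ u ⁆ ∪ ⁅ v ⁆ ⊆ X
pair-⊆ u∈X v∈X x∈uv with ∈-pair x∈uv
... | inj₁ refl = u∈X
... | inj₂ refl = v∈X

itemset-Adj : ∀ {K} {F : Family K} → Antimonotonic F → ∀ {U} → F U → ∀ {a b} → a ∈ U → b ∈ U → a ≢ b → Adj F a b
itemset-Adj anti {U} FU {a} {b} a∈U b∈U a≢b = a≢b , anti U _ (pair-⊆ a∈U b∈U) FU

pair-comm : ∀ {u v : Fin n} {U} → U ⊆ ⁅ u ⁆ ∪ ⁅ v ⁆ → U ⊆ ⁅ v ⁆ ∪ ⁅ u ⁆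
pair-comm {u = u} {v} U⊆uv = subst (_ ⊆_) (∪-comm ⁅ u ⁆ ⁅ v ⁆) U⊆uv

⊆-pair-∌ : ∀ {u v : Fin n} {U} → U ⊆ ⁅ u ⁆ ∪ ⁅ v ⁆ → v ∉ U → U ⊆ ⁅ u ⁆
⊆-pair-∌ U⊆uv v∉U x∈U with ∈-pair (U⊆uv x∈U)
... | inj₁ refl = x∈⁅x⁆ _
... | inj₂ refl = ⊥-elim (v∉U x∈U)

⊆⁅u⁆⇒∈ : ∀ {u : Fin n} {U} → U ⊆ ⁅ u ⁆ → ∀ {x} → x ∈ U → u ∈ U
⊆⁅u⁆⇒∈ {u = u} U⊆u x∈U = subst (_∈ _) (x∈⁅y⁆⇒x≡y u (U⊆u x∈U)) x∈U

StepOutside : ∀ {K} → Family K → Subset K → Fin K → Fin K → Set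
StepOutside F X a b = Adj F a b × b ∉ X

-- Adjacency is not decidable, hence the double negation.
BypassAdjacent : ∀ {K} → Family K → Subset K → Set
BypassAdjacent F X = ∀ {u v w} → u ∈ X → v ∈ X → u ≢ v →
  Star (StepOutside F X) u w → Adj F w v → ¬ ¬ Adj F u v

half quarter : ℚ
half    = ℤ.+ 1 / 2
quarter = ℤ.+ 1 / 4

-- The frequencies of U under the uniform distribution on the subsets of
-- {u, v} and under ½δ_∅ + ½δ_{u, v}: they differ only if U ⊇ {u, v}.
pair-indicator-average : ∀ {u v : Fin n} → u ≢ v → ∀ U → ¬ (u ∈ U × v ∈ U) →
  quarter * Ind U ∅ + (quarter * Ind U ⁅ u ⁆ + (quarter * Ind U ⁅ v ⁆ + (quarter * Ind U (⁅ u ⁆ ∪ ⁅ v ⁆) + 0ℚ)))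
  ≡ half * Ind U ∅ + (half * Ind U (⁅ u ⁆ ∪ ⁅ v ⁆) + 0ℚ)
pair-indicator-average {u = u} {v} u≢v U ¬both with U ⊆? (⁅ u ⁆ ∪ ⁅ v ⁆) | u ∈? U | v ∈? U
... | no U⊈uv | _ | _
  rewrite Ind-⊈ {U = U} {∅}      (λ U⊆∅ → U⊈uv λ x∈U → ⊥-elim (∉⊥ (U⊆∅ x∈U)))
        | Ind-⊈ {U = U} {⁅ u ⁆} (λ U⊆u → U⊈uv λ x∈U → p⊆p∪q ⁅ v ⁆ (U⊆u x∈U))
        | Ind-⊈ {U = U} {⁅ v ⁆} (λ U⊆v → U⊈uv λ x∈U → q⊆p∪q ⁅ u ⁆ ⁅ v ⁆ (U⊆v x∈U)) = refl
... | yes _ | yes u∈U | yes v∈U = ⊥-elim (¬both (u∈U , v∈U))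
... | yes U⊆uv | no u∉U | no v∉U
  rewrite Ind-⊆ {U = U} {∅}      (λ x∈U → ⊥-elim (u∉U (⊆⁅u⁆⇒∈ (⊆-pair-∌ U⊆uv v∉U) x∈U)))
        | Ind-⊆ {U = U} {⁅ u ⁆} (⊆-pair-∌ U⊆uv v∉U)
        | Ind-⊆ {U = U} {⁅ v ⁆} (⊆-pair-∌ (pair-comm U⊆uv) u∉U) = refl
... | yes U⊆uv | yes u∈U | no v∉U
  rewrite Ind-⊈ {U = U} {∅}      (λ U⊆∅ → ∉⊥ (U⊆∅ u∈U))
        | Ind-⊆ {U = U} {⁅ u ⁆} (⊆-pair-∌ U⊆uv v∉U)
        | Ind-⊈ {U = U} {⁅ v ⁆} (λ U⊆v → u≢v (x∈⁅y⁆⇒x≡y v (U⊆v u∈U))) = refl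
... | yes U⊆uv | no u∉U | yes v∈U
  rewrite Ind-⊈ {U = U} {∅}      (λ U⊆∅ → ∉⊥ (U⊆∅ v∈U))
        | Ind-⊈ {U = U} {⁅ u ⁆} (λ U⊆u → u≢v (sym (x∈⁅y⁆⇒x≡y u (U⊆u v∈U))))
        | Ind-⊆ {U = U} {⁅ v ⁆} (⊆-pair-∌ (pair-comm U⊆uv) u∉U) = refl

-- Let Y contain v and everything reachable from u outside C.  Under
-- p₀ = ½δ_∅ + ½δ_Y adjacent items of Y have equal frequencies, so every
-- distribution with the frequencies of p₀ puts u ∈ z ⇒ v ∈ z almost surely.
-- The uniform distribution q on the subsets of {u, v} has those frequencies
-- on every itemset of F inside C, as {u, v} ∉ F; yet q ⁅ u ⁆ = ¼.
module BypassCounterexample {K} {F : Family K} (anti : Antimonotonic F) {C : Subset K}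
  {u v w : Fin K} (u∈C : u ∈ C) (v∈C : v ∈ C) (u≢v : u ≢ v) (¬uv : ¬ Adj F u v)
  (path : Star (StepOutside F C) u w) (wv : Adj F w v)
  (Y : Subset K) (v∈Y : v ∈ Y) (reach⊆Y : ∀ {t} → Star (StepOutside F C) u t → t ∈ Y)
  (Y∩C⊆uv : ∀ {t} → t ∈ Y → t ∈ C → t ≡ u ⊎ t ≡ v) where

  uv : Subset K
  uv = ⁅ u ⁆ ∪ ⁅ v ⁆

  u∈Y : u ∈ Y
  u∈Y = reach⊆Y ε

  uv⊆C : uv ⊆ C
  uv⊆C = pair-⊆ u∈C v∈C

  p₀-weights q-weights : List (ℚ × Subset K)
  p₀-weights = (half , ∅) ∷ (half , Y) ∷ []
  q-weights  = (quarter , ∅) ∷ (quarter , ⁅ u ⁆) ∷ (quarter , ⁅ v ⁆) ∷ (quarter , uv) ∷ []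

  p₀ : Dist K
  p₀ = mixtureDist p₀-weights (Q.nonNegative⁻¹ half ∷ Q.nonNegative⁻¹ half ∷ []) refl

  θ : Subset K → ℚ
  θ = Freq p₀

  q : Dist K
  q = mixtureDist q-weights (q≥0 ∷ q≥0 ∷ q≥0 ∷ q≥0 ∷ []) refl
    where q≥0 = Q.nonNegative⁻¹ quarter

  q-on-C : SupportedOn C q
  q-on-C z z∩C≢z = mixture-≡0 {ws = q-weights}
    (≢ ⊥⊆ ∷ ≢ (uv⊆C ∘ p⊆p∪q ⁅ v ⁆) ∷ ≢ (uv⊆C ∘ q⊆p∪q ⁅ u ⁆ ⁅ v ⁆) ∷ ≢ uv⊆C ∷ [])
    where
    ≢ : ∀ {w'} → w' ⊆ C → z ≢ w'
    ≢ {w'} w'⊆C refl = z∩C≢z (⊆ᵇ⇒∩≡ w' C (⊆⇒⊆ᵇ w' C w'⊆C))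

  Ind-Y : ∀ U → U ⊆ C → Ind U Y ≡ Ind U uv
  Ind-Y U U⊆C with U ⊆? uv
  ... | yes U⊆uv = Ind-⊆ (pair-⊆ u∈Y v∈Y ∘ U⊆uv)
  ... | no  U⊈uv = Ind-⊈ λ U⊆Y → U⊈uv λ x∈U → x∈pair (Y∩C⊆uv (U⊆Y x∈U) (U⊆C x∈U))
    where
    x∈pair : ∀ {x} → x ≡ u ⊎ x ≡ v → x ∈ uv
    x∈pair (inj₁ refl) = p⊆p∪q ⁅ v ⁆ (x∈⁅x⁆ u)
    x∈pair (inj₂ refl) = q⊆p∪q ⁅ u ⁆ ⁅ v ⁆ (x∈⁅x⁆ v)

  q⊨θ : ∀ U → F U → U ⊆ C → Freq q U ≡ θ U
  q⊨θ U FU U⊆C = begin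
    Freq q U
      ≡⟨ Σpts-mixture K q-weights (Ind U) ⟩
    quarter * Ind U ∅ + (quarter * Ind U ⁅ u ⁆ + (quarter * Ind U ⁅ v ⁆ + (quarter * Ind U uv + 0ℚ)))
      ≡⟨ pair-indicator-average u≢v U (λ (u∈U , v∈U) → ¬uv (itemset-Adj anti FU u∈U v∈U u≢v)) ⟩
    half * Ind U ∅ + (half * Ind U uv + 0ℚ)
      ≡⟨ cong (λ x → half * Ind U ∅ + (half * x + 0ℚ)) (Ind-Y U U⊆C) ⟨
    half * Ind U ∅ + (half * Ind U Y + 0ℚ)
      ≡⟨ Σpts-mixture K p₀-weights (Ind U) ⟨
    θ U ∎
    where open ≡-Reasoning

  module _ (p : Dist K) (p⊨θ : Satisfies F p θ) where

    θ-⊆Y : ∀ {X x} → X ⊆ Y → x ∈ X → θ X ≡ half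
    θ-⊆Y {X} X⊆Y x∈X = trans (Σpts-mixture K p₀-weights (Ind X))
      (cong₂ (λ i j → half * i + (half * j + 0ℚ)) (Ind-⊈ (λ X⊆⊥ → ∉⊥ (X⊆⊥ x∈X))) (Ind-⊆ X⊆Y))

    adjacent-forces : ∀ {a b} → Adj F a b → a ∈ Y → b ∈ Y → ∀ z → prob p z ≢ 0ℚ → a ∈ z → b ∈ z
    adjacent-forces {a} {b} ab a∈Y b∈Y z pz≢0 a∈z with b ∈? z
    ... | yes b∈z = b∈z
    ... | no  b∉z = ⊥-elim (pz≢0 (freq-≡⇒⊆-forces (prob p) (nonneg p) (p⊆p∪q ⁅ b ⁆) equal-freq z
                      (λ x∈a → subst (_∈ z) (sym (x∈⁅y⁆⇒x≡y a x∈a)) a∈z)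
                      (λ ab⊆z → b∉z (ab⊆z (q⊆p∪q ⁅ a ⁆ ⁅ b ⁆ (x∈⁅x⁆ b))))))
      where
      ab⊆Y : ⁅ a ⁆ ∪ ⁅ b ⁆ ⊆ Y
      ab⊆Y = pair-⊆ a∈Y b∈Y
      equal-freq : Freq p ⁅ a ⁆ ≡ Freq p (⁅ a ⁆ ∪ ⁅ b ⁆)
      equal-freq = begin
        Freq p ⁅ a ⁆            ≡⟨ p⊨θ ⁅ a ⁆ (anti _ ⁅ a ⁆ (p⊆p∪q ⁅ b ⁆) (proj₂ ab)) ⟩
        θ ⁅ a ⁆                 ≡⟨ θ-⊆Y (ab⊆Y ∘ p⊆p∪q ⁅ b ⁆) (x∈⁅x⁆ a) ⟩
        half                    ≡⟨ θ-⊆Y ab⊆Y (p⊆p∪q ⁅ b ⁆ (x∈⁅x⁆ a)) ⟨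
        θ (⁅ a ⁆ ∪ ⁅ b ⁆)       ≡⟨ p⊨θ _ (proj₂ ab) ⟨
        Freq p (⁅ a ⁆ ∪ ⁅ b ⁆)  ∎
        where open ≡-Reasoning

    reach-forces : ∀ z → prob p z ≢ 0ℚ → ∀ {s t} → Star (StepOutside F C) u s →
      Star (StepOutside F C) s t → s ∈ z → t ∈ z
    reach-forces z pz≢0 u⇝s ε s∈z = s∈z
    reach-forces z pz≢0 u⇝s (step@(sa , _) ◅ a⇝t) s∈z =
      reach-forces z pz≢0 u⇝a a⇝t (adjacent-forces sa (reach⊆Y u⇝s) (reach⊆Y u⇝a) z pz≢0 s∈z)
      where
      u⇝a : Star (StepOutside F C) u _
      u⇝a = u⇝s ◅◅ (step ◅ ε)

    u-forces-v : ∀ z → prob p z ≢ 0ℚ → u ∈ z → v ∈ z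
    u-forces-v z pz≢0 u∈z = adjacent-forces wv (reach⊆Y path) v∈Y z pz≢0 (reach-forces z pz≢0 ε path u∈z)

    marginal-u≡0 : Marginal C p ⁅ u ⁆ ≡ 0ℚ
    marginal-u≡0 = trans (Σpts-cong K term≡0) (Σpts-0 K)
      where
      term≡0 : ∀ z → (if does (≡-dec BoolP._≟_ (z ∩ C) ⁅ u ⁆) then prob p z else 0ℚ) ≡ 0ℚ
      term≡0 z with ≡-dec BoolP._≟_ (z ∩ C) ⁅ u ⁆
      ... | no  _      = refl
      ... | yes z∩C≡u with prob p z Q.≟ 0ℚ
      ...   | yes pz≡0 = pz≡0
      ...   | no  pz≢0 = ⊥-elim (u≢v (sym (x∈⁅y⁆⇒x≡y u (subst (v ∈_) z∩C≡u (x∈p∩q⁺ (v∈z , v∈C))))))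
        where
        v∈z : v ∈ z
        v∈z = u-forces-v z pz≢0 (proj₁ (x∈p∩q⁻ z C (subst (u ∈_) (sym z∩C≡u) (x∈⁅x⁆ u))))

    not-extension : ¬ (∀ z' → z' ⊆ C → Marginal C p z' ≡ prob q z')
    not-extension extends = case trans (sym marginal-u≡0) (trans (extends ⁅ u ⁆ (uv⊆C ∘ p⊆p∪q ⁅ v ⁆)) q-u) of λ ()
      where
      q-u : prob q ⁅ u ⁆ ≡ quarter
      q-u rewrite δ-≢ {w = ∅} {⁅ u ⁆} (λ u≡∅ → ∉⊥ (subst (u ∈_) u≡∅ (x∈⁅x⁆ u)))
                | δ-≡ ⁅ u ⁆
                | δ-≢ {w = ⁅ v ⁆} {⁅ u ⁆} (λ u≡v → u≢v (x∈⁅y⁆⇒x≡y v (subst (u ∈_) u≡v (x∈⁅x⁆ u))))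
                | δ-≢ {w = uv} {⁅ u ⁆}
                    (λ u≡uv → u≢v (sym (x∈⁅y⁆⇒x≡y u (subst (v ∈_) (sym u≡uv) (q⊆p∪q ⁅ u ⁆ ⁅ v ⁆ (x∈⁅x⁆ v))))))
                = refl

  not-safe : ¬ Safe F C
  not-safe safe = refute (safe θ (p₀ , λ _ _ → refl) q q-on-C q⊨θ)
    where
    refute : ¬ (∃[ p ] (Satisfies F p θ × (∀ z' → z' ⊆ C → Marginal C p z' ≡ prob q z')))
    refute (p , p⊨θ , extends) = not-extension p p⊨θ extends

reach-ends-outside : ∀ {K} {F : Family K} {C u t} → Star (StepOutside F C) u t → t ≡ u ⊎ t ∉ C
reach-ends-outside ε = inj₁ refl
reach-ends-outside {F = F} ((_ , b∉C) ◅ b⇝t) with reach-ends-outside {F = F} b⇝t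
... | inj₁ refl = inj₂ b∉C
... | inj₂ t∉C  = inj₂ t∉C

safe⇒bypassAdjacent : ∀ {K} {F : Family K} → Antimonotonic F → ∀ {C} → Safe F C → BypassAdjacent F C
safe⇒bypassAdjacent {K} {F} anti {C} safe {u} {v} u∈C v∈C u≢v path wv ¬uv =
  ¬¬-decidable K (λ t → t ≡ v ⊎ Star (StepOutside F C) u t) λ decide →
    let open Comprehension (comprehension decide) renaming (set to Y) in
    BypassCounterexample.not-safe anti u∈C v∈C u≢v ¬uv path wv Y (complete (inj₁ refl)) (complete ∘ inj₂)
      (λ t∈Y t∈C → Y∩C t∈C (sound t∈Y)) safe
  where
  Y∩C : ∀ {t} → t ∈ C → t ≡ v ⊎ Star (StepOutside F C) u t → t ≡ u ⊎ t ≡ v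
  Y∩C t∈C (inj₁ t≡v) = inj₂ t≡v
  Y∩C t∈C (inj₂ u⇝t) with reach-ends-outside {F = F} u⇝t
  ... | inj₁ t≡u = inj₁ t≡u
  ... | inj₂ t∉C = ⊥-elim (t∉C t∈C)

-- Paths and the junction tree

least-≤ : (P : ℕ → Set) → (∀ i → Dec (P i)) → ∀ n →
  (∃[ k ] (k ≤ n × P k × (∀ i → i < k → ¬ P i))) ⊎ (∀ i → i ≤ n → ¬ P i)
least-≤ P P? zero with P? zero
... | yes P0 = inj₁ (zero , z≤n , P0 , λ _ ())
... | no ¬P0 = inj₂ λ { zero _ → ¬P0 }
least-≤ P P? (suc n) with least-≤ P P? n
... | inj₁ (k , k≤n , Pk , below) = inj₁ (k , ℕP.m≤n⇒m≤1+n k≤n , Pk , below)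
... | inj₂ none with P? (suc n)
...   | yes Pn = inj₁ (suc n , ℕP.≤-refl , Pn , λ i i<1+n → none i (ℕP.≤-pred i<1+n))
...   | no ¬Pn = inj₂ λ i i≤1+n → [ (λ i<1+n → none i (ℕP.≤-pred i<1+n)) , (λ { refl → ¬Pn }) ]
                         (ℕP.m≤n⇒m<n∨m≡n i≤1+n)

greatest-≤ : (P : ℕ → Set) → (∀ i → Dec (P i)) → ∀ n →
  (∃[ k ] (k ≤ n × P k × (∀ i → k < i → i ≤ n → ¬ P i))) ⊎ (∀ i → i ≤ n → ¬ P i)
greatest-≤ P P? zero with P? zero
... | yes P0 = inj₁ (zero , z≤n , P0 , λ i 0<i i≤0 → ⊥-elim (ℕP.<⇒≱ 0<i i≤0))
... | no ¬P0 = inj₂ λ { zero _ → ¬P0 }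
greatest-≤ P P? (suc n) with P? (suc n)
... | yes Pn = inj₁ (suc n , ℕP.≤-refl , Pn , λ i 1+n<i i≤1+n → ⊥-elim (ℕP.<⇒≱ 1+n<i i≤1+n))
... | no ¬Pn with greatest-≤ P P? n
...   | inj₁ (k , k≤n , Pk , above) = inj₁ (k , ℕP.m≤n⇒m≤1+n k≤n , Pk , λ i k<i i≤1+n →
          [ (λ i<1+n → above i k<i (ℕP.≤-pred i<1+n)) , (λ { refl → ¬Pn }) ] (ℕP.m≤n⇒m<n∨m≡n i≤1+n))
...   | inj₂ none = inj₂ λ i i≤1+n →
          [ (λ i<1+n → none i (ℕP.≤-pred i<1+n)) , (λ { refl → ¬Pn }) ] (ℕP.m≤n⇒m<n∨m≡n i≤1+n)

-- Paths with pairwise distinct vertices, indexed by ℕ (a convenient form of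
-- Defs.SimplePath for arithmetic on positions).
record Path {m} (R : Fin m → Fin m → Set) (x y : Fin m) : Set where
  field
    len      : ℕ
    at       : ℕ → Fin m
    start    : at 0 ≡ x
    end      : at len ≡ y
    distinct : ∀ i j → i ≤ len → j ≤ len → at i ≡ at j → i ≡ j
    step     : ∀ k → k < len → R (at k) (at (suc k))

module _ {m} {R : Fin m → Fin m → Set} where

  open Path

  path-refl : ∀ x → Path R x x
  path-refl x = record
    { len = 0 ; at = λ _ → x ; start = refl ; end = refl
    ; distinct = λ { zero zero _ _ _ → refl } ; step = λ _ () }

  path-cons : ∀ {x y z} → R x y → (p : Path R y z) → (∀ i → i ≤ len p → at p i ≢ x) → Path R x z
  path-cons {x} r p x∉p = record
    { len = suc (len p) ; at = at' ; start = refl ; end = end p ; distinct = distinct' ; step = step' }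
    where
    at' : ℕ → Fin m
    at' zero    = x
    at' (suc i) = at p i
    distinct' : ∀ i j → i ≤ suc (len p) → j ≤ suc (len p) → at' i ≡ at' j → i ≡ j
    distinct' zero    zero    _  _  _ = refl
    distinct' zero    (suc j) _  hj e = ⊥-elim (x∉p j (ℕP.≤-pred hj) (sym e))
    distinct' (suc i) zero    hi _  e = ⊥-elim (x∉p i (ℕP.≤-pred hi) e)
    distinct' (suc i) (suc j) hi hj e = cong suc (distinct p i j (ℕP.≤-pred hi) (ℕP.≤-pred hj) e)
    step' : ∀ k → k < suc (len p) → R (at' k) (at' (suc k))
    step' zero    _ = subst (R x) (sym (start p)) r
    step' (suc k) h = step p k (ℕP.≤-pred h)

  path-drop : ∀ {x z} → (p : Path R x z) → ∀ k → k ≤ len p → Path R (at p k) z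
  path-drop p k k≤len = record
    { len = len p ∸ k ; at = λ i → at p (k ℕ.+ i) ; start = cong (at p) (ℕP.+-identityʳ k)
    ; end = trans (cong (at p) (ℕP.m+[n∸m]≡n k≤len)) (end p) ; distinct = distinct' ; step = step' }
    where
    bound : ∀ i → i ≤ len p ∸ k → k ℕ.+ i ≤ len p
    bound i h = subst (k ℕ.+ i ≤_) (ℕP.m+[n∸m]≡n k≤len) (ℕP.+-monoʳ-≤ k h)
    distinct' : ∀ i j → i ≤ len p ∸ k → j ≤ len p ∸ k → at p (k ℕ.+ i) ≡ at p (k ℕ.+ j) → i ≡ j
    distinct' i j hi hj e = ℕP.+-cancelˡ-≡ k i j (distinct p (k ℕ.+ i) (k ℕ.+ j) (bound i hi) (bound j hj) e)
    step' : ∀ i → i < len p ∸ k → R (at p (k ℕ.+ i)) (at p (k ℕ.+ suc i))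
    step' i h = subst (λ t → R (at p (k ℕ.+ i)) (at p t)) (sym (ℕP.+-suc k i))
      (step p (k ℕ.+ i) (subst (_≤ len p) (ℕP.+-suc k i) (bound (suc i) h)))

  -- Loop erasure: if the start recurs on the erased tail, restart there.
  walk⇒path : ∀ {x y} → Star R x y → Path R x y
  walk⇒path {x} ε = path-refl x
  walk⇒path {x} {y} (r ◅ rest) with least-≤ (λ i → at p i ≡ x) (λ i → at p i FinP.≟ x) (len p)
    where p = walk⇒path rest
  ... | inj₁ (k , k≤len , at≡x , _) = subst (λ t → Path R t y) at≡x (path-drop (walk⇒path rest) k k≤len)
  ... | inj₂ x∉p = path-cons r (walk⇒path rest) x∉p

  path⇒walk : ∀ {x y} → Path R x y → Star R x y
  path⇒walk {x} {y} p = subst₂ (Star R) (start p) (end p) (from (len p) 0 (ℕP.+-identityʳ (len p)))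
    where
    from : ∀ n i → n ℕ.+ i ≡ len p → Star R (at p i) (at p (len p))
    from zero    i e = subst (λ t → Star R (at p i) (at p t)) e ε
    from (suc n) i e = step p i (subst (suc i ≤_) e (s≤s (ℕP.m≤n+m i n))) ◅ from n (suc i) (trans (ℕP.+-suc n i) e)

  path-map : ∀ {R' : Fin m → Fin m → Set} {x y} → (∀ {a b} → R a b → R' a b) → Path R x y → Path R' x y
  path-map f p = record
    { len = len p ; at = at p ; start = start p ; end = end p ; distinct = distinct p ; step = λ k h → f (step p k h) }

  path⇒simplePath : ∀ {x y} → Path R x y → SimplePath R x y
  path⇒simplePath p = record
    { len   = len p
    ; vert  = λ k → at p (toℕ k)
    ; inj   = λ {i} {j} e → FinP.toℕ-injective
                (distinct p (toℕ i) (toℕ j) (ℕP.≤-pred (FinP.toℕ<n i)) (ℕP.≤-pred (FinP.toℕ<n j)) e)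
    ; start = start p
    ; end   = trans (cong (at p) (FinP.toℕ-fromℕ (len p))) (end p)
    ; step  = λ k k' e → subst (λ t → R (at p (toℕ k)) (at p t)) (sym e)
                (step p (toℕ k) (subst (_≤ len p) e (ℕP.≤-pred (FinP.toℕ<n k'))))
    }

  simplePath⇒path : ∀ {x y} → SimplePath R x y → Path R x y
  simplePath⇒path {x} {y} sp = record
    { len = L ; at = at' ; start = start' ; end = end' ; distinct = distinct' ; step = step' }
    where
    module P = SimplePath sp
    L = P.len
    at' : ℕ → Fin m
    at' i with i ℕP.<? suc L
    ... | yes i<1+L = P.vert (fromℕ< i<1+L)
    ... | no  _     = P.vert zero
    at'≡ : ∀ i (h : i < suc L) → at' i ≡ P.vert (fromℕ< h)
    at'≡ i h with i ℕP.<? suc L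
    ... | yes h' = cong P.vert (FinP.toℕ-injective (trans (FinP.toℕ-fromℕ< h') (sym (FinP.toℕ-fromℕ< h))))
    ... | no ¬h  = ⊥-elim (¬h h)
    start' : at' 0 ≡ x
    start' = trans (at'≡ 0 (s≤s z≤n)) P.start
    end' : at' L ≡ y
    end' = trans (at'≡ L ℕP.≤-refl)
      (trans (cong P.vert (FinP.toℕ-injective (trans (FinP.toℕ-fromℕ< ℕP.≤-refl) (sym (FinP.toℕ-fromℕ L))))) P.end)
    distinct' : ∀ i j → i ≤ L → j ≤ L → at' i ≡ at' j → i ≡ j
    distinct' i j hi hj e = trans (sym (FinP.toℕ-fromℕ< (s≤s hi)))
      (trans (cong toℕ (P.inj (trans (sym (at'≡ i (s≤s hi))) (trans e (at'≡ j (s≤s hj)))))) (FinP.toℕ-fromℕ< (s≤s hj)))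
    step' : ∀ k → k < L → R (at' k) (at' (suc k))
    step' k h = subst₂ R (sym (at'≡ k (ℕP.m≤n⇒m≤1+n h))) (sym (at'≡ (suc k) (s≤s h)))
      (P.step (fromℕ< (ℕP.m≤n⇒m≤1+n h)) (fromℕ< (s≤s h))
        (trans (FinP.toℕ-fromℕ< (s≤s h)) (cong suc (sym (FinP.toℕ-fromℕ< (ℕP.m≤n⇒m≤1+n h))))))

  simplePath⇒path-at : ∀ {x y} (sp : SimplePath R x y) (k : Fin (suc (SimplePath.len sp))) →
    at (simplePath⇒path sp) (toℕ k) ≡ SimplePath.vert sp k
  simplePath⇒path-at sp k with toℕ k ℕP.<? suc (SimplePath.len sp)
  ... | yes h = cong (SimplePath.vert sp) (FinP.toℕ-injective (FinP.toℕ-fromℕ< h))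
  ... | no ¬h = ⊥-elim (¬h (FinP.toℕ<n k))

  path+edge⇒cycle : ∀ {x y} → (p : Path R x y) → R y x → Cycle R (suc (len p))
  path+edge⇒cycle {x} {y} p r = record
    { vert = λ k → at p (toℕ k)
    ; inj  = λ {i} {j} e → FinP.toℕ-injective
               (distinct p (toℕ i) (toℕ j) (ℕP.≤-pred (FinP.toℕ<n i)) (ℕP.≤-pred (FinP.toℕ<n j)) e)
    ; step = step'
    }
    where
    step' : ∀ i j → CycSucc (suc (len p)) i j → R (at p (toℕ i)) (at p (toℕ j))
    step' i j (inj₁ e) = subst (λ t → R (at p (toℕ i)) (at p t)) (sym e)
      (step p (toℕ i) (subst (_≤ len p) e (ℕP.≤-pred (FinP.toℕ<n j))))
    step' i j (inj₂ (e₁ , e₂)) =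
      subst₂ R (trans (sym (end p)) (cong (at p) (sym (ℕP.suc-injective e₁)))) (trans (sym (start p)) (cong (at p) (sym e₂))) r

module TreeStructure {K} {F : Family K} {m e} {cl : Fin m → Subset K} {edges : Fin e → Fin m × Fin m}
  (jt : JunctionTree F m e cl edges) where

  open JunctionTree jt
  open Path

  T : Fin m → Fin m → Set
  T = TAdj edges

  T-sym : ∀ {a b} → T a b → T b a
  T-sym (i , inj₁ e) = i , inj₂ e
  T-sym (i , inj₂ e) = i , inj₁ e

  T-irrefl : ∀ {a} → ¬ T a a
  T-irrefl (i , inj₁ e) = edge-loop i _ e
  T-irrefl (i , inj₂ e) = edge-loop i _ e

  tree-path : ∀ Q Q' → Path T Q Q'
  tree-path Q Q' = walk⇒path (connected Q Q')

  rip-path : ∀ {Q Q' a} → a ∈ cl Q → a ∈ cl Q' → (p : Path T Q Q') → ∀ i → i ≤ len p → a ∈ cl (at p i)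
  rip-path {Q} {Q'} {a} a∈Q a∈Q' p i i≤len = subst (λ t → a ∈ cl (at p t)) (FinP.toℕ-fromℕ< (s≤s i≤len))
    (rip Q Q' a a∈Q a∈Q' (path⇒simplePath p) (fromℕ< (s≤s i≤len)))

  module EdgeSides (Q₁ Q₂ : Fin m) (tq : T Q₁ Q₂) where

    IsEdge : Fin m → Fin m → Set
    IsEdge a b = (a ≡ Q₁ × b ≡ Q₂) ⊎ (a ≡ Q₂ × b ≡ Q₁)

    IsEdge? : ∀ a b → Dec (IsEdge a b)
    IsEdge? a b = (a FinP.≟ Q₁ ×-dec b FinP.≟ Q₂) ⊎-dec (a FinP.≟ Q₂ ×-dec b FinP.≟ Q₁)

    IsEdge-sym : ∀ {a b} → IsEdge a b → IsEdge b a
    IsEdge-sym (inj₁ (a≡ , b≡)) = inj₂ (b≡ , a≡)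
    IsEdge-sym (inj₂ (a≡ , b≡)) = inj₁ (b≡ , a≡)

    Off : Fin m → Fin m → Set
    Off a b = T a b × ¬ IsEdge a b

    Off-sym : ∀ {a b} → Off a b → Off b a
    Off-sym (t , ¬e) = T-sym t , λ e → ¬e (IsEdge-sym e)

    side₁ side₂ : Fin m → Set
    side₁ = Star Off Q₁
    side₂ = Star Off Q₂

    Q₁≢Q₂ : Q₁ ≢ Q₂
    Q₁≢Q₂ refl = T-irrefl tq

    _▷_ : ∀ {A R R'} → Star Off A R → Off R R' → Star Off A R'
    s ▷ r = s ◅◅ (r ◅ ε)

    sides-cover : ∀ R → side₁ R ⊎ side₂ R
    sides-cover R = go (connected Q₁ R) (inj₁ ε)
      where
      go : ∀ {a b} → Star T a b → side₁ a ⊎ side₂ a → side₁ b ⊎ side₂ b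
      go ε s = s
      go {a} (_◅_ {j = a'} t rest) s with IsEdge? a a'
      ... | yes (inj₁ (_ , refl)) = go rest (inj₂ ε)
      ... | yes (inj₂ (_ , refl)) = go rest (inj₁ ε)
      ... | no ¬e with s
      ...   | inj₁ s₁ = go rest (inj₁ (s₁ ▷ (t , ¬e)))
      ...   | inj₂ s₂ = go rest (inj₂ (s₂ ▷ (t , ¬e)))

    -- A vertex on both sides would close a cycle through the edge.
    sides-disjoint : ∀ {R} → side₁ R → side₂ R → ⊥
    sides-disjoint s₁ s₂ = by-length (len p) refl
      where
      p : Path Off Q₂ Q₁
      p = walk⇒path (s₂ ◅◅ reverse Off-sym s₁)
      by-length : ∀ n → len p ≡ n → ⊥
      by-length zero          e = Q₁≢Q₂ (trans (sym (end p)) (trans (cong (at p) e) (start p)))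
      by-length (suc zero)    e = proj₂ (step p 0 (subst (0 <_) (sym e) (s≤s z≤n)))
                                    (inj₂ (start p , trans (cong (at p) (sym e)) (end p)))
      by-length (suc (suc n)) e = acyclic (suc (len p)) (subst (λ l → 3 ≤ suc l) (sym e) (s≤s (s≤s (s≤s z≤n))))
                                    (path+edge⇒cycle (path-map proj₁ p) tq)

    edge-once : ∀ {A B} (p : Path T A B) k k' → k < len p → k' < len p →
      IsEdge (at p k) (at p (suc k)) → IsEdge (at p k') (at p (suc k')) → k ≡ k'
    edge-once p k k' k<len k'<len e e' = by-orientation e e'
      where
      same : ∀ {i j} → i ≤ len p → j ≤ len p → at p i ≡ at p j → i ≡ j
      same {i} {j} = distinct p i j
      flipped : at p k ≡ at p (suc k') → at p (suc k) ≡ at p k' → ⊥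
      flipped a b = ℕP.<-irrefl (trans (sym k+1≡k') (cong suc k≡k'+1)) (ℕP.m≤n⇒m≤1+n (ℕP.n<1+n k'))
        where
        k≡k'+1 : k ≡ suc k'
        k≡k'+1 = same (ℕP.<⇒≤ k<len) k'<len a
        k+1≡k' : suc k ≡ k'
        k+1≡k' = same k<len (ℕP.<⇒≤ k'<len) b
      by-orientation : IsEdge (at p k) (at p (suc k)) → IsEdge (at p k') (at p (suc k')) → k ≡ k'
      by-orientation (inj₁ (a , _)) (inj₁ (a' , _)) = same (ℕP.<⇒≤ k<len) (ℕP.<⇒≤ k'<len) (trans a (sym a'))
      by-orientation (inj₂ (a , _)) (inj₂ (a' , _)) = same (ℕP.<⇒≤ k<len) (ℕP.<⇒≤ k'<len) (trans a (sym a'))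
      by-orientation (inj₁ (a , b)) (inj₂ (a' , b')) = ⊥-elim (flipped (trans a (sym b')) (trans b (sym a')))
      by-orientation (inj₂ (a , b)) (inj₁ (a' , b')) = ⊥-elim (flipped (trans a (sym b')) (trans b (sym a')))

    Off-closed : (Fin m → Set) → Set
    Off-closed S = ∀ {a b} → S a → Off a b → S b

    module _ {A B} (p : Path T A B) {S : Fin m → Set} (S-closed : Off-closed S) where

      private
        i<i+1+n : ∀ i n → i < i ℕ.+ suc n
        i<i+1+n i n = subst (i <_) (sym (ℕP.+-suc i n)) (s≤s (ℕP.m≤m+n i n))

      crossing : ∀ n i → i ℕ.+ n ≤ len p → S (at p i) → ¬ S (at p (i ℕ.+ n)) →
        ∃[ k ] (i ≤ k × k < i ℕ.+ n × IsEdge (at p k) (at p (suc k)))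
      crossing zero    i _ Si ¬Si+0 = ⊥-elim (¬Si+0 (subst (λ t → S (at p t)) (sym (ℕP.+-identityʳ i)) Si))
      crossing (suc n) i h Si ¬Si+n with IsEdge? (at p i) (at p (suc i))
      ... | yes edge = i , ℕP.≤-refl , i<i+1+n i n , edge
      ... | no ¬edge with crossing n (suc i) (subst (_≤ len p) (ℕP.+-suc i n) h)
                            (S-closed Si (step p i (ℕP.<-≤-trans (i<i+1+n i n) h) , ¬edge))
                            (subst (λ t → ¬ S (at p t)) (ℕP.+-suc i n) ¬Si+n)
      ...   | k , i<k , k<i+1+n , edge = k , ℕP.<⇒≤ i<k , subst (k <_) (sym (ℕP.+-suc i n)) k<i+1+n , edge

      staying : ∀ n i → i ℕ.+ n ≤ len p → S (at p i) →
        (∀ k → i ≤ k → k < i ℕ.+ n → ¬ IsEdge (at p k) (at p (suc k))) → S (at p (i ℕ.+ n))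
      staying zero    i _ Si _     = subst (λ t → S (at p t)) (sym (ℕP.+-identityʳ i)) Si
      staying (suc n) i h Si clear = subst (λ t → S (at p t)) (sym (ℕP.+-suc i n))
        (staying n (suc i) (subst (_≤ len p) (ℕP.+-suc i n) h)
          (S-closed Si (step p i (ℕP.<-≤-trans (i<i+1+n i n) h) , clear i ℕP.≤-refl (i<i+1+n i n)))
          (λ k i<k k< → clear k (ℕP.<⇒≤ i<k) (subst (k <_) (sym (ℕP.+-suc i n)) k<)))

      staying-back : ∀ n i → i ℕ.+ n ≤ len p → S (at p (i ℕ.+ n)) →
        (∀ k → i ≤ k → k < i ℕ.+ n → ¬ IsEdge (at p k) (at p (suc k))) → S (at p i)
      staying-back zero    i _ Si+0 _     = subst (λ t → S (at p t)) (ℕP.+-identityʳ i) Si+0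
      staying-back (suc n) i h Si+n clear = S-closed Si+1 (Off-sym (step p i (ℕP.<-≤-trans (i<i+1+n i n) h) ,
                                                                    clear i ℕP.≤-refl (i<i+1+n i n)))
        where
        Si+1 : S (at p (suc i))
        Si+1 = staying-back n (suc i) (subst (_≤ len p) (ℕP.+-suc i n) h)
          (subst (λ t → S (at p t)) (ℕP.+-suc i n) Si+n)
          (λ k i<k k< → clear k (ℕP.<⇒≤ i<k) (subst (k <_) (sym (ℕP.+-suc i n)) k<))

    -- By the running intersection property, along the tree path through the edge.
    both-sides⇒separator : ∀ {R R' a} → a ∈ cl R → a ∈ cl R' → side₁ R → side₂ R' → a ∈ cl Q₁ × a ∈ cl Q₂
    both-sides⇒separator {R} {R'} {a} a∈R a∈R' s₁ s₂ =
      through (walk⇒path (gmap id proj₁ (reverse Off-sym s₁) ◅◅ (tq ◅ gmap id proj₁ s₂)))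
      where
      through : Path T R R' → a ∈ cl Q₁ × a ∈ cl Q₂
      through p with least-≤ (λ k → k < len p × IsEdge (at p k) (at p (suc k)))
                             (λ k → (k ℕP.<? len p) ×-dec IsEdge? (at p k) (at p (suc k))) (len p)
      ... | inj₁ (k , _ , (k<len , edge) , _) = at-edge edge
        where
        a∈k : a ∈ cl (at p k)
        a∈k = rip-path a∈R a∈R' p k (ℕP.<⇒≤ k<len)
        a∈k+1 : a ∈ cl (at p (suc k))
        a∈k+1 = rip-path a∈R a∈R' p (suc k) k<len
        at-edge : IsEdge (at p k) (at p (suc k)) → a ∈ cl Q₁ × a ∈ cl Q₂
        at-edge (inj₁ (k≡1 , k+1≡2)) = subst (λ t → a ∈ cl t) k≡1 a∈k , subst (λ t → a ∈ cl t) k+1≡2 a∈k+1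
        at-edge (inj₂ (k≡2 , k+1≡1)) = subst (λ t → a ∈ cl t) k+1≡1 a∈k+1 , subst (λ t → a ∈ cl t) k≡2 a∈k
      ... | inj₂ no-edge = ⊥-elim (sides-disjoint (s₁ ◅◅ path⇒walk p-off) s₂)
        where
        p-off : Path Off R R'
        p-off = record { len = len p ; at = at p ; start = start p ; end = end p ; distinct = distinct p
                       ; step = λ k k<len → step p k k<len , λ edge → no-edge k (ℕP.<⇒≤ k<len) (k<len , edge) }

module Cliques {K} (F : Family K) (F? : ∀ U → Dec (F U)) where

  Adj? : ∀ i j → Dec (Adj F i j)
  Adj? i j = ¬? (i FinP.≟ j) ×-dec F? (⁅ i ⁆ ∪ ⁅ j ⁆)

  AdjacentToAll : Fin K → Subset K → Set
  AdjacentToAll i W = ∀ j → j ∈ W → j ≢ i → Adj F i j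

  AdjacentToAll? : ∀ i W → Dec (AdjacentToAll i W)
  AdjacentToAll? i W = FinP.all? λ j → (j ∈? W) →-dec (¬? (j FinP.≟ i) →-dec Adj? i j)

  clique-∪-singleton : ∀ {i W} → IsClique F W → AdjacentToAll i W → IsClique F (W ∪ ⁅ i ⁆)
  clique-∪-singleton {i} {W} W-clique i~W a b a∈ b∈ a≢b with x∈p∪q⁻ W ⁅ i ⁆ a∈ | x∈p∪q⁻ W ⁅ i ⁆ b∈
  ... | inj₁ a∈W | inj₁ b∈W = W-clique a b a∈W b∈W a≢b
  ... | inj₁ a∈W | inj₂ b∈i rewrite x∈⁅y⁆⇒x≡y i b∈i = Adj-sym F (i~W a a∈W a≢b)
  ... | inj₂ a∈i | inj₁ b∈W rewrite x∈⁅y⁆⇒x≡y i a∈i = i~W b b∈W (a≢b ∘ sym)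
  ... | inj₂ a∈i | inj₂ b∈i = ⊥-elim (a≢b (trans (x∈⁅y⁆⇒x≡y i a∈i) (sym (x∈⁅y⁆⇒x≡y i b∈i))))

  record Extension (W : Subset K) (is : List (Fin K)) : Set where
    field
      V        : Subset K
      W⊆V      : W ⊆ V
      clique   : IsClique F V
      rejected : ∀ {i} → i ∈ₗ is → i ∈ V ⊎ ∃[ j ] (j ∈ V × j ≢ i × ¬ Adj F i j)

  extend : ∀ {W} → IsClique F W → ∀ is → Extension W is
  extend {W} W-clique [] = record { V = W ; W⊆V = id ; clique = W-clique ; rejected = λ () }
  extend {W} W-clique (i ∷ is) with AdjacentToAll? i W
  ... | yes i~W = record { V = V ; W⊆V = W⊆V ∘ p⊆p∪q ⁅ i ⁆ ; clique = clique ; rejected = rejected' }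
    where
    open Extension (extend (clique-∪-singleton W-clique i~W) is)
    rejected' : ∀ {i'} → i' ∈ₗ (i ∷ is) → i' ∈ V ⊎ ∃[ j ] (j ∈ V × j ≢ i' × ¬ Adj F i' j)
    rejected' (here refl) = inj₁ (W⊆V (q⊆p∪q W ⁅ i ⁆ (x∈⁅x⁆ i)))
    rejected' (there i'∈is) = rejected i'∈is
  ... | no ¬i~W = record { V = V ; W⊆V = W⊆V ; clique = clique ; rejected = rejected' }
    where
    open Extension (extend W-clique is)
    witness : ∃[ j ] (j ∈ W × j ≢ i × ¬ Adj F i j)
    witness with FinP.¬∀⟶∃¬ K _ (λ j → (j ∈? W) →-dec (¬? (j FinP.≟ i) →-dec Adj? i j)) ¬i~W
    ... | j , ¬j with j ∈? W | j FinP.≟ i | Adj? i j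
    ...   | yes j∈W | no j≢i | no ¬ij = j , j∈W , j≢i , ¬ij
    ...   | yes _   | no _   | yes ij = ⊥-elim (¬j λ _ _ → ij)
    ...   | yes _   | yes j≡i | _     = ⊥-elim (¬j λ _ j≢i → ⊥-elim (j≢i j≡i))
    ...   | no j∉W  | _      | _      = ⊥-elim (¬j λ j∈W → ⊥-elim (j∉W j∈W))
    rejected' : ∀ {i'} → i' ∈ₗ (i ∷ is) → i' ∈ V ⊎ ∃[ j ] (j ∈ V × j ≢ i' × ¬ Adj F i' j)
    rejected' (here refl) with witness
    ... | j , j∈W , j≢i , ¬ij = inj₂ (j , W⊆V j∈W , j≢i , ¬ij)
    rejected' (there i'∈is) = rejected i'∈is

  extend-to-maximal : ∀ {W} → IsClique F W → Σ (Subset K) λ V → IsMaxClique F V × W ⊆ V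
  extend-to-maximal W-clique = V , (clique , maximal) , W⊆V
    where
    open Extension (extend W-clique (allFin K))
    maximal : ∀ W' → IsClique F W' → V ⊆ W' → W' ≡ V
    maximal W' W'-clique V⊆W' = ⊆-antisym W'⊆V V⊆W'
      where
      W'⊆V : W' ⊆ V
      W'⊆V {i} i∈W' with rejected (∈-allFin i)
      ... | inj₁ i∈V = i∈V
      ... | inj₂ (j , j∈V , j≢i , ¬ij) = ⊥-elim (¬ij (W'-clique i j i∈W' (V⊆W' j∈V) (j≢i ∘ sym)))

  infrequent-clique-maximal : CliqueSafe F → ∀ {N} → IsClique F N → ¬ F N → IsMaxClique F N
  infrequent-clique-maximal cs {N} N-clique ¬FN with extend-to-maximal N-clique
  ... | V , V-max , N⊆V with FinP.any? (λ t → (t ∈? V) ×-dec ¬? (t ∈? N))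
  ...   | yes (t , t∈V , t∉N) = ⊥-elim (¬FN (cs V V-max N (N⊆V , t , t∈V , t∉N)))
  ...   | no  V⊆N = subst (IsMaxClique F) (⊆-antisym V⊆N' N⊆V) V-max
    where
    V⊆N' : V ⊆ N
    V⊆N' {t} t∈V with t ∈? N
    ... | yes t∈N = t∈N
    ... | no  t∉N = ⊥-elim (V⊆N (t , t∈V , t∉N))

  module InTree {m e} {cl : Fin m → Subset K} {edges : Fin e → Fin m × Fin m}
                (jt : JunctionTree F m e cl edges) where

    open JunctionTree jt

    clique⊆tree-clique : ∀ {W} → IsClique F W → ∃[ Q ] (W ⊆ cl Q)
    clique⊆tree-clique W-clique with extend-to-maximal W-clique
    ... | V , V-max , W⊆V with cl-all V V-max
    ...   | Q , clQ≡V = Q , subst (_ ∈_) (sym clQ≡V) ∘ W⊆V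

    singleton-clique : ∀ a → IsClique F ⁅ a ⁆
    singleton-clique a i j i∈a j∈a i≢j = ⊥-elim (i≢j (trans (x∈⁅y⁆⇒x≡y a i∈a) (sym (x∈⁅y⁆⇒x≡y a j∈a))))

    item-clique : ∀ a → ∃[ Q ] (a ∈ cl Q)
    item-clique a with clique⊆tree-clique (singleton-clique a)
    ... | Q , a⊆Q = Q , a⊆Q (x∈⁅x⁆ a)

    edge-clique : ∀ {a b} → Adj F a b → ∃[ Q ] (a ∈ cl Q × b ∈ cl Q)
    edge-clique {a} {b} ab with clique⊆tree-clique pair-clique
      where
      pair-clique : IsClique F (⁅ a ⁆ ∪ ⁅ b ⁆)
      pair-clique i j i∈ j∈ i≢j with x∈p∪q⁻ ⁅ a ⁆ ⁅ b ⁆ i∈ | x∈p∪q⁻ ⁅ a ⁆ ⁅ b ⁆ j∈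
      ... | inj₁ i∈a | inj₁ j∈a = ⊥-elim (i≢j (trans (x∈⁅y⁆⇒x≡y a i∈a) (sym (x∈⁅y⁆⇒x≡y a j∈a))))
      ... | inj₂ i∈b | inj₂ j∈b = ⊥-elim (i≢j (trans (x∈⁅y⁆⇒x≡y b i∈b) (sym (x∈⁅y⁆⇒x≡y b j∈b))))
      ... | inj₁ i∈a | inj₂ j∈b rewrite x∈⁅y⁆⇒x≡y a i∈a | x∈⁅y⁆⇒x≡y b j∈b = ab
      ... | inj₂ i∈b | inj₁ j∈a rewrite x∈⁅y⁆⇒x≡y b i∈b | x∈⁅y⁆⇒x≡y a j∈a = Adj-sym F ab
    ... | Q , ab⊆Q = Q , ab⊆Q (p⊆p∪q ⁅ b ⁆ (x∈⁅x⁆ a)) , ab⊆Q (q⊆p∪q ⁅ a ⁆ ⁅ b ⁆ (x∈⁅x⁆ b))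

    clique-adjacent : ∀ Q {a b} → a ∈ cl Q → b ∈ cl Q → a ≢ b → Adj F a b
    clique-adjacent Q a∈Q b∈Q a≢b = proj₁ (cl-max Q) _ _ a∈Q b∈Q a≢b

Sep-∈⁻ : ∀ {K m e} {cl : Fin m → Subset K} {edges : Fin e → Fin m × Fin m} i {A B} →
  edges i ≡ (A , B) ⊎ edges i ≡ (B , A) → ∀ {a} → a ∈ Sep cl edges i → a ∈ cl A × a ∈ cl B
Sep-∈⁻ {cl = cl} {edges} i e a∈Sep with edges i | e
... | _ | inj₁ refl = x∈p∩q⁻ _ _ a∈Sep
... | _ | inj₂ refl = ×-swap (x∈p∩q⁻ _ _ a∈Sep)

Sep-∈⁺ : ∀ {K m e} {cl : Fin m → Subset K} {edges : Fin e → Fin m × Fin m} i {A B} →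
  edges i ≡ (A , B) ⊎ edges i ≡ (B , A) → ∀ {a} → a ∈ cl A → a ∈ cl B → a ∈ Sep cl edges i
Sep-∈⁺ {cl = cl} {edges} i e a∈A a∈B with edges i | e
... | _ | inj₁ refl = x∈p∩q⁺ (a∈A , a∈B)
... | _ | inj₂ refl = x∈p∩q⁺ (a∈B , a∈A)

module JunctionTreeFacts {K} {F : Family K} (F? : ∀ U → Dec (F U))
  {m e} {cl : Fin m → Subset K} {edges : Fin e → Fin m × Fin m} (jt : JunctionTree F m e cl edges) where

  open JunctionTree jt
  open TreeStructure jt public
  open Cliques F F? public
  open InTree jt public
  open Path

  module ItemSides (Q₁ Q₂ : Fin m) (tq : T Q₁ Q₂) where

    open EdgeSides Q₁ Q₂ tq public

    Strictly₁ Strictly₂ : Fin K → Set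
    Strictly₁ a = ∀ {R} → a ∈ cl R → side₁ R
    Strictly₂ a = ∀ {R} → a ∈ cl R → side₂ R

    NotInSeparator : Fin K → Set
    NotInSeparator a = ¬ (a ∈ cl Q₁ × a ∈ cl Q₂)

    strictly₁ : ∀ {a R₀} → a ∈ cl R₀ → side₁ R₀ → NotInSeparator a → Strictly₁ a
    strictly₁ {R₀ = R₀} a∈R₀ s₀ a∉Sep {R} a∈R with sides-cover R
    ... | inj₁ s = s
    ... | inj₂ s = ⊥-elim (a∉Sep (both-sides⇒separator a∈R₀ a∈R s₀ s))

    strictly₂ : ∀ {a R₀} → a ∈ cl R₀ → side₂ R₀ → NotInSeparator a → Strictly₂ a
    strictly₂ {R₀ = R₀} a∈R₀ s₀ a∉Sep {R} a∈R with sides-cover R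
    ... | inj₂ s = s
    ... | inj₁ s = ⊥-elim (a∉Sep (both-sides⇒separator a∈R a∈R₀ s s₀))

    strictly-some-side : ∀ {a} → NotInSeparator a → Strictly₁ a ⊎ Strictly₂ a
    strictly-some-side {a} a∉Sep with item-clique a
    ... | R , a∈R with sides-cover R
    ...   | inj₁ s = inj₁ (strictly₁ a∈R s a∉Sep)
    ...   | inj₂ s = inj₂ (strictly₂ a∈R s a∉Sep)

    ¬strictly-both : ∀ {a} → Strictly₁ a → Strictly₂ a → ⊥
    ¬strictly-both {a} s₁ s₂ with item-clique a
    ... | R , a∈R = sides-disjoint (s₁ a∈R) (s₂ a∈R)

    strictly-opposite⇒¬Adj : ∀ {a b} → Strictly₁ a → Strictly₂ b → ¬ Adj F a b
    strictly-opposite⇒¬Adj s₁ s₂ ab with edge-clique ab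
    ... | R , a∈R , b∈R = sides-disjoint (s₁ a∈R) (s₂ b∈R)

    strictly₂-Adj : ∀ {a b} → Strictly₂ a → Adj F a b → NotInSeparator b → Strictly₂ b
    strictly₂-Adj s₂ ab b∉Sep with edge-clique ab
    ... | R , a∈R , b∈R = strictly₂ b∈R (s₂ a∈R) b∉Sep

    -- Lets the lemmas below serve both orientations of the edge.
    record Bipartition : Set₁ where
      field
        S S'      : Fin m → Set
        S-closed  : Off-closed S
        S'-closed : Off-closed S'
        cover     : ∀ R → S R ⊎ S' R
        disjoint  : ∀ {R} → S R → S' R → ⊥

    sides₁₂ sides₂₁ : Bipartition
    sides₁₂ = record { S = side₁ ; S' = side₂ ; S-closed = _▷_ ; S'-closed = _▷_
                     ; cover = sides-cover ; disjoint = sides-disjoint }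
    sides₂₁ = record { S = side₂ ; S' = side₁ ; S-closed = _▷_ ; S'-closed = _▷_
                     ; cover = swap ∘ sides-cover ; disjoint = λ s₂ s₁ → sides-disjoint s₁ s₂ }

    -- A tree path crosses the edge Q₁ — Q₂ at most once.
    endpoint-on-side : (bp : Bipartition) → ∀ {A B} (p : Path T A B) k → suc k ≤ len p →
      Bipartition.S bp (at p k) → Bipartition.S bp (at p (suc k)) → Bipartition.S bp A ⊎ Bipartition.S bp B
    endpoint-on-side bp p k k<len Sk Sk+1 with cover (at p 0) | cover (at p (len p))
      where open Bipartition bp
    ... | inj₁ S₀ | _ = inj₁ (subst S (start p) S₀) where open Bipartition bp
    ... | inj₂ _  | inj₁ Sₗ = inj₂ (subst S (end p) Sₗ) where open Bipartition bp
    ... | inj₂ S'₀ | inj₂ S'ₗ with crossing p S'-closed k 0 (ℕP.≤-trans (ℕP.n≤1+n k) k<len) S'₀ (λ S'k → disjoint Sk S'k)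
                                | crossing p S-closed (len p ∸ suc k) (suc k) (ℕP.≤-reflexive (ℕP.m+[n∸m]≡n k<len)) Sk+1
                                    (λ Sₗ → disjoint (subst (λ t → S (at p t)) (ℕP.m+[n∸m]≡n k<len) Sₗ) S'ₗ)
      where open Bipartition bp
    ...   | k₁ , _ , k₁<k , edge₁ | k₂ , k<k₂ , k₂<len , edge₂ =
      ⊥-elim (ℕP.<-irrefl (edge-once p k₁ k₂ k₁<len k₂<len' edge₁ edge₂)
                          (ℕP.<-≤-trans (ℕP.<-trans k₁<k (ℕP.n<1+n k)) k<k₂))
      where
      k₁<len : k₁ < len p
      k₁<len = ℕP.<-≤-trans k₁<k (ℕP.≤-trans (ℕP.n≤1+n k) k<len)
      k₂<len' : k₂ < len p
      k₂<len' = ℕP.<-≤-trans k₂<len (ℕP.≤-reflexive (ℕP.m+[n∸m]≡n k<len))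

module InnerSeparators {K} {F : Family K} (F? : ∀ U → Dec (F U))
  {m e} {cl : Fin m → Subset K} {edges : Fin e → Fin m × Fin m} (jt : JunctionTree F m e cl edges)
  {B : Subset K} (ch : CliqueChoice cl B) {S : Subset e} (S-inner : InnerSet edges ch S) where

  open JunctionTreeFacts F? jt
  open CliqueChoice ch
  open Path

  Admissible : Fin K → Set
  Admissible t = t ∈ B ⊎ ∃[ i ] (i ∈ S × t ∈ Sep cl edges i)

  module InnerEdge (Q₁ Q₂ : Fin m) (tq : T Q₁ Q₂) where

    open ItemSides Q₁ Q₂ tq public

    chosen-on-side : (bp : Bipartition) → ∀ {a} → Admissible a → (∀ {R} → a ∈ cl R → Bipartition.S bp R) →
      ∃[ b ] Σ (b ∈ B) λ b∈B → Bipartition.S bp (pick b b∈B)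
    chosen-on-side bp (inj₁ a∈B) strict = _ , a∈B , strict (pick-∈ _ a∈B)
    chosen-on-side bp {a} (inj₂ (i , i∈S , a∈Sep)) strict with proj₁ (S-inner i) i∈S
    ... | b , c , b∈B , c∈B , sp , k , k' , k'≡k+1 , edge-i
      with endpoint-on-side bp (simplePath⇒path sp) (toℕ k) k<len
             (subst (Bipartition.S bp) (sym (simplePath⇒path-at sp k)) (strict (proj₁ a∈ends)))
             (subst (Bipartition.S bp) (trans (sym (simplePath⇒path-at sp k')) (cong (at (simplePath⇒path sp)) k'≡k+1))
               (strict (proj₂ a∈ends)))
      where
      a∈ends : a ∈ cl (SimplePath.vert sp k) × a ∈ cl (SimplePath.vert sp k')
      a∈ends = Sep-∈⁻ {cl = cl} {edges} i edge-i a∈Sep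
      k<len : suc (toℕ k) ≤ len (simplePath⇒path sp)
      k<len = subst (_≤ SimplePath.len sp) k'≡k+1 (ℕP.≤-pred (FinP.toℕ<n k'))
    ... | inj₁ Sb = b , b∈B , Sb
    ... | inj₂ Sc = c , c∈B , Sc

    crossing⇒OnPath : ∀ {A A'} (p : Path T A A') k (k<len : k < len p) → IsEdge (at p k) (at p (suc k)) →
      OnPath edges A A' (proj₁ tq)
    crossing⇒OnPath p k k<len edge =
      path⇒simplePath p , fromℕ< (ℕP.m≤n⇒m≤1+n k<len) , fromℕ< (s≤s k<len) ,
      trans (FinP.toℕ-fromℕ< (s≤s k<len)) (cong suc (sym (FinP.toℕ-fromℕ< (ℕP.m≤n⇒m≤1+n k<len)))) ,
      orient edge (proj₂ tq)
      where
      at-k : at p (toℕ (fromℕ< (ℕP.m≤n⇒m≤1+n k<len))) ≡ at p k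
      at-k = cong (at p) (FinP.toℕ-fromℕ< (ℕP.m≤n⇒m≤1+n k<len))
      at-k+1 : at p (toℕ (fromℕ< (s≤s k<len))) ≡ at p (suc k)
      at-k+1 = cong (at p) (FinP.toℕ-fromℕ< (s≤s k<len))
      orient : IsEdge (at p k) (at p (suc k)) → edges (proj₁ tq) ≡ (Q₁ , Q₂) ⊎ edges (proj₁ tq) ≡ (Q₂ , Q₁) →
        edges (proj₁ tq) ≡ (at p (toℕ (fromℕ< (ℕP.m≤n⇒m≤1+n k<len))) , at p (toℕ (fromℕ< (s≤s k<len))))
        ⊎ edges (proj₁ tq) ≡ (at p (toℕ (fromℕ< (s≤s k<len))) , at p (toℕ (fromℕ< (ℕP.m≤n⇒m≤1+n k<len))))
      orient (inj₁ (k≡1 , k+1≡2)) (inj₁ e) = inj₁ (trans e (cong₂ _,_ (sym (trans at-k k≡1)) (sym (trans at-k+1 k+1≡2))))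
      orient (inj₁ (k≡1 , k+1≡2)) (inj₂ e) = inj₂ (trans e (cong₂ _,_ (sym (trans at-k+1 k+1≡2)) (sym (trans at-k k≡1))))
      orient (inj₂ (k≡2 , k+1≡1)) (inj₁ e) = inj₂ (trans e (cong₂ _,_ (sym (trans at-k+1 k+1≡1)) (sym (trans at-k k≡2))))
      orient (inj₂ (k≡2 , k+1≡1)) (inj₂ e) = inj₁ (trans e (cong₂ _,_ (sym (trans at-k k≡2)) (sym (trans at-k+1 k+1≡1))))

    inner-if-separating : (∃[ b ] Σ (b ∈ B) λ b∈B → side₁ (pick b b∈B)) →
      (∃[ c ] Σ (c ∈ B) λ c∈B → side₂ (pick c c∈B)) → proj₁ tq ∈ S
    inner-if-separating (b , b∈B , s₁) (c , c∈B , s₂)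
      with crossing p _▷_ (len p) 0 ℕP.≤-refl (subst side₁ (sym (start p)) s₁)
             (λ s₁' → sides-disjoint s₁' (subst side₂ (sym (end p)) s₂))
      where p = tree-path (pick b b∈B) (pick c c∈B)
    ... | k , _ , k<len , edge =
      proj₂ (S-inner (proj₁ tq)) (b , c , b∈B , c∈B , crossing⇒OnPath (tree-path (pick b b∈B) (pick c c∈B)) k k<len edge)

    separator-admissible : proj₁ tq ∈ S → ∀ {t} → t ∈ cl Q₁ → t ∈ cl Q₂ → Admissible t
    separator-admissible e∈S t∈Q₁ t∈Q₂ =
      inj₂ (proj₁ tq , e∈S , Sep-∈⁺ {cl = cl} {edges} (proj₁ tq) (proj₂ tq) t∈Q₁ t∈Q₂)

  -- Let u, v ∈ C ∩ A be non-adjacent and joined by a bypass of C ∩ A.  On the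
  -- tree path from a clique of u to one of v, the edge leaving the last
  -- clique containing u has u strictly on one side and v strictly on the
  -- other, so it is inner and its separator is admissible.  The items of C
  -- on the bypass are not admissible, hence strictly on one side; two
  -- consecutive ones on opposite sides are non-adjacent, joined by a bypass of C.
  module Restriction {C : Subset K} (C' : Comprehension (λ t → t ∈ C × Admissible t))
                     (C-bypass : BypassAdjacent F C) where

    open Comprehension C' renaming (set to C∩A)

    module Scan (Q₁ Q₂ : Fin m) (tq : T Q₁ Q₂) (e∈S : proj₁ tq ∈ S)
                {v w} (v∈C : v ∈ C) (wv : Adj F w v) where

      open InnerEdge Q₁ Q₂ tq

      scan : Strictly₂ v → ∀ {t} → Star (StepOutside F C∩A) t w →
             ∀ {c} → c ∈ C → Strictly₁ c → Star (StepOutside F C) c t → ⊥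
      scan s₂v ε c∈C s₁c c⇝w =
        C-bypass c∈C v∈C (λ { refl → ¬strictly-both s₁c s₂v }) c⇝w wv (strictly-opposite⇒¬Adj s₁c s₂v)
      scan s₂v (_◅_ {j = b} (tb , b∉C∩A) b⇝w) c∈C s₁c c⇝t with b ∈? C
      ... | no  b∉C = scan s₂v b⇝w c∈C s₁c (c⇝t ◅◅ ((tb , b∉C) ◅ ε))
      ... | yes b∈C
        with strictly-some-side (λ b∈Sep → b∉C∩A (complete (b∈C , separator-admissible e∈S (proj₁ b∈Sep) (proj₂ b∈Sep))))
      ...   | inj₁ s₁b = scan s₂v b⇝w b∈C s₁b ε
      ...   | inj₂ s₂b = C-bypass c∈C b∈C (λ { refl → ¬strictly-both s₁c s₂b }) c⇝t tb (strictly-opposite⇒¬Adj s₁c s₂b)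

    from-last-clique : ∀ {u v w} → u ∈ C∩A → v ∈ C∩A → u ≢ v → Star (StepOutside F C∩A) u w → Adj F w v →
      ¬ Adj F u v → ∀ {Ru Rv} → v ∈ cl Rv → (p : Path T Ru Rv) → ∀ j → j ≤ len p → u ∈ cl (at p j) →
      (∀ i → j < i → i ≤ len p → u ∉ cl (at p i)) → ⊥
    from-last-clique {u} {v} u∈C∩A v∈C∩A u≢v path wv ¬uv {Rv = Rv} v∈Rv p j j≤len u∈j last =
      Scan.scan Q₁ Q₂ tq e∈S (proj₁ (sound v∈C∩A)) wv s₂v path (proj₁ (sound u∈C∩A)) s₁u ε
      where
      j<len : j < len p
      j<len = ℕP.≤∧≢⇒< j≤len λ j≡len →
        ¬uv (clique-adjacent Rv (subst (λ R → u ∈ cl R) (trans (cong (at p) j≡len) (end p)) u∈j) v∈Rv u≢v)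
      Q₁ Q₂ : Fin m
      Q₁ = at p j
      Q₂ = at p (suc j)
      tq : T Q₁ Q₂
      tq = step p j j<len
      open InnerEdge Q₁ Q₂ tq
      len≡ : suc j ℕ.+ (len p ∸ suc j) ≡ len p
      len≡ = ℕP.m+[n∸m]≡n j<len
      end-side₂ : side₂ (at p (len p))
      end-side₂ = subst (λ t → side₂ (at p t)) len≡
        (staying p _▷_ (len p ∸ suc j) (suc j) (ℕP.≤-reflexive len≡) ε
          λ k j<k k<len edge → ℕP.<-irrefl (edge-once p j k j<len (ℕP.<-≤-trans k<len (ℕP.≤-reflexive len≡))
                                            (inj₁ (refl , refl)) edge) j<k)
      s₁u : Strictly₁ u
      s₁u = strictly₁ u∈j ε λ u∈Sep → last (suc j) (ℕP.n<1+n j) j<len (proj₂ u∈Sep)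
      s₂v : Strictly₂ v
      s₂v = strictly₂ (subst (λ R → v ∈ cl R) (sym (end p)) v∈Rv) end-side₂
              λ v∈Sep → ¬uv (clique-adjacent Q₁ u∈j (proj₁ v∈Sep) u≢v)
      e∈S : proj₁ tq ∈ S
      e∈S = inner-if-separating (chosen-on-side sides₁₂ (proj₂ (sound u∈C∩A)) s₁u)
                                (chosen-on-side sides₂₁ (proj₂ (sound v∈C∩A)) s₂v)

    bypassAdjacent-restrict : BypassAdjacent F C∩A
    bypassAdjacent-restrict {u} {v} u∈C∩A v∈C∩A u≢v path wv ¬uv with item-clique u | item-clique v
    ... | Ru , u∈Ru | Rv , v∈Rv
      with greatest-≤ (λ k → u ∈ cl (at p k)) (λ k → u ∈? cl (at p k)) (len p)
      where p = tree-path Ru Rv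
    ...   | inj₁ (j , j≤len , u∈j , last) =
      from-last-clique u∈C∩A v∈C∩A u≢v path wv ¬uv v∈Rv (tree-path Ru Rv) j j≤len u∈j last
    ...   | inj₂ nowhere = nowhere 0 z≤n (subst (λ R → u ∈ cl R) (sym (start (tree-path Ru Rv))) u∈Ru)

-- Neighbourhoods of components

StepAvoiding : ∀ {K} → Family K → Subset K → Fin K → Fin K → Set
StepAvoiding F X a b = Adj F a b × a ∉ X × b ∉ X

module _ {K} (F : Family K) {X : Subset K} where

  StepAvoiding-sym : ∀ {a b} → StepAvoiding F X a b → StepAvoiding F X b a
  StepAvoiding-sym (ab , a∉X , b∉X) = Adj-sym F ab , b∉X , a∉X

  avoiding-end : ∀ {a b} → Star (StepAvoiding F X) a b → a ∉ X → b ∉ X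
  avoiding-end ε                 a∉X = a∉X
  avoiding-end ((_ , _ , c∉X) ◅ rest) _ = avoiding-end rest c∉X

  avoiding⇒outside : ∀ {a b} → StepAvoiding F X a b → StepOutside F X a b
  avoiding⇒outside (ab , _ , b∉X) = ab , b∉X

-- D is the component of y in G − X and N its neighbourhood in X.  N is a
-- clique, as two of its items are joined by a bypass of X through D.  If
-- N ∉ F, clique safety makes N a maximal clique, hence a node Q of the
-- junction tree.  On the tree path from Q towards D, let Q₁ — Q₂ be the edge
-- where D is first met.  Its separator is inside N, so D lies strictly on the
-- side of Q₂ and N, being adjacent to D, inside cl Q₂; maximality of N gives
-- cl Q₂ = N, which meets D.
module Neighbourhood {K} {F : Family K} (F? : ∀ U → Dec (F U)) (cs : CliqueSafe F)
  {m e} {cl : Fin m → Subset K} {edges : Fin e → Fin m × Fin m} (jt : JunctionTree F m e cl edges)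
  {X : Subset K} (X-bypass : BypassAdjacent F X) {y : Fin K} (y∉X : y ∉ X)
  (D : Comprehension (λ t → y ∉ X × Star (StepAvoiding F X) y t))
  (N : Comprehension (λ c → c ∈ X × ∃[ d ] (d ∈ Comprehension.set D × Adj F d c))) where

  open JunctionTree jt
  open JunctionTreeFacts F? jt
  open Path
  open Comprehension D using () renaming (set to Dₛ; sound to D-sound; complete to D-complete)
  open Comprehension N using () renaming (set to Nₛ; sound to N-sound; complete to N-complete)

  D-reach : ∀ {t} → t ∈ Dₛ → Star (StepAvoiding F X) y t
  D-reach = proj₂ ∘ D-sound

  D-outside : ∀ {t} → t ∈ Dₛ → t ∉ X
  D-outside t∈D = avoiding-end F (D-reach t∈D) y∉X

  D-closed : ∀ {d s} → d ∈ Dₛ → Adj F d s → s ∉ X → s ∈ Dₛ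
  D-closed d∈D ds s∉X = D-complete (y∉X , D-reach d∈D ◅◅ ((ds , D-outside d∈D , s∉X) ◅ ε))

  N-inside : ∀ {c} → c ∈ Nₛ → c ∈ X
  N-inside = proj₁ ∘ N-sound

  N-neighbour : ∀ {c} → c ∈ Nₛ → ∃[ d ] (d ∈ Dₛ × Adj F d c)
  N-neighbour = proj₂ ∘ N-sound

  N-clique : IsClique F Nₛ
  N-clique a b a∈N b∈N a≢b with Adj? a b | N-neighbour a∈N | N-neighbour b∈N
  ... | yes ab | _ | _ = ab
  ... | no ¬ab | da , da∈D , da~a | db , db∈D , db~b =
    ⊥-elim (X-bypass (N-inside a∈N) (N-inside b∈N) a≢b bypass db~b ¬ab)
    where
    bypass : Star (StepOutside F X) a db
    bypass = (Adj-sym F da~a , D-outside da∈D)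
           ◅ gmap (λ x → x) (avoiding⇒outside F) (reverse (StepAvoiding-sym F) (D-reach da∈D) ◅◅ D-reach db∈D)

  module FirstContact (Q R₀ : Fin m) (Q≡N : cl Q ≡ Nₛ) (N-max : IsMaxClique F Nₛ) (j : ℕ)
    (j<len : suc j ≤ len (tree-path Q R₀)) {d'} (d'∈D : d' ∈ Dₛ) (d'∈Q₂ : d' ∈ cl (at (tree-path Q R₀) (suc j)))
    (untouched : ∀ i → i < suc j → ¬ (∃[ t ] (t ∈ Dₛ × t ∈ cl (at (tree-path Q R₀) i)))) where

    p : Path T Q R₀
    p = tree-path Q R₀
    Q₁ Q₂ : Fin m
    Q₁ = at p j
    Q₂ = at p (suc j)
    tq : T Q₁ Q₂
    tq = step p j j<len
    open ItemSides Q₁ Q₂ tq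

    D∉Q₁ : ∀ {t} → t ∈ Dₛ → t ∉ cl Q₁
    D∉Q₁ t∈D t∈Q₁ = untouched j (ℕP.n<1+n j) (_ , t∈D , t∈Q₁)

    d'~s : ∀ {s} → s ∈ cl Q₁ → s ∈ cl Q₂ → Adj F d' s
    d'~s s∈Q₁ s∈Q₂ = clique-adjacent Q₂ d'∈Q₂ s∈Q₂ λ { refl → D∉Q₁ d'∈D s∈Q₁ }

    separator⊆N : ∀ {s} → s ∈ cl Q₁ → s ∈ cl Q₂ → s ∈ Nₛ
    separator⊆N {s} s∈Q₁ s∈Q₂ with s ∈? X
    ... | yes s∈X = N-complete (s∈X , d' , d'∈D , d'~s s∈Q₁ s∈Q₂)
    ... | no  s∉X = ⊥-elim (D∉Q₁ (D-closed d'∈D (d'~s s∈Q₁ s∈Q₂) s∉X) s∈Q₁)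

    D-strictly₂ : ∀ {t} → t ∈ Dₛ → Strictly₂ t
    D-strictly₂ t∈D = along (reverse (StepAvoiding-sym F) (D-reach d'∈D) ◅◅ D-reach t∈D)
                        (strictly₂ d'∈Q₂ ε λ d'∈Sep → D∉Q₁ d'∈D (proj₁ d'∈Sep))
      where
      along : ∀ {a b} → Star (StepAvoiding F X) a b → Strictly₂ a → Strictly₂ b
      along ε                          s₂a = s₂a
      along ((ab , _ , b∉X) ◅ rest) s₂a =
        along rest (strictly₂-Adj s₂a ab λ b∈Sep → b∉X (N-inside (separator⊆N (proj₁ b∈Sep) (proj₂ b∈Sep))))

    Q-side₁ : side₁ Q
    Q-side₁ = subst side₁ (start p) (staying-back p _▷_ j 0 (ℕP.<⇒≤ j<len) ε
      λ k _ k<j edge → ℕP.<-irrefl (edge-once p k j (ℕP.<-trans k<j j<len) j<len edge (inj₁ (refl , refl))) k<j)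

    contradiction : ⊥
    contradiction with FinP.any? (λ v → (v ∈? Nₛ) ×-dec ¬? ((v ∈? cl Q₁) ×-dec (v ∈? cl Q₂)))
    ... | yes (v , v∈N , v∉Sep) with N-neighbour v∈N
    ...   | d , d∈D , d~v = strictly-opposite⇒¬Adj (strictly₁ (subst (v ∈_) (sym Q≡N) v∈N) Q-side₁ v∉Sep)
                              (D-strictly₂ d∈D) (Adj-sym F d~v)
    contradiction | no N⊆Sep = D-outside d'∈D (N-inside (subst (d' ∈_) Q₂≡N d'∈Q₂))
      where
      N⊆Q₂ : Nₛ ⊆ cl Q₂
      N⊆Q₂ {v} v∈N with v ∈? cl Q₁ | v ∈? cl Q₂
      ... | _       | yes v∈Q₂ = v∈Q₂
      ... | yes v∈Q₁ | no v∉Q₂ = ⊥-elim (N⊆Sep (v , v∈N , λ v∈Sep → v∉Q₂ (proj₂ v∈Sep)))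
      ... | no v∉Q₁  | no _    = ⊥-elim (N⊆Sep (v , v∈N , λ v∈Sep → v∉Q₁ (proj₁ v∈Sep)))
      Q₂≡N : cl Q₂ ≡ Nₛ
      Q₂≡N = proj₂ N-max (cl Q₂) (proj₁ (cl-max Q₂)) N⊆Q₂

  ¬maximal : ¬ IsMaxClique F Nₛ
  ¬maximal N-max with FinP.any? (_∈? Nₛ)
  ... | no empty = y∉X (N-inside (subst (y ∈_) (proj₂ N-max ⁅ y ⁆ (singleton-clique y) (λ v∈N → ⊥-elim (empty (_ , v∈N))))
                                    (x∈⁅x⁆ y)))
  ... | yes (v , v∈N) with N-neighbour v∈N | cl-all Nₛ N-max
  ...   | d , d∈D , d~v | Q , Q≡N with edge-clique d~v
  ...     | R₀ , d∈R₀ , _ with least-≤ (λ k → ∃[ t ] (t ∈ Dₛ × t ∈ cl (at (tree-path Q R₀) k)))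
                                       (λ k → FinP.any? (λ t → (t ∈? Dₛ) ×-dec (t ∈? cl (at (tree-path Q R₀) k))))
                                       (len (tree-path Q R₀))
  ...       | inj₂ never =
    never (len (tree-path Q R₀)) ℕP.≤-refl (d , d∈D , subst (λ R → d ∈ cl R) (sym (end (tree-path Q R₀))) d∈R₀)
  ...       | inj₁ (zero , _ , (t , t∈D , t∈Q) , _) =
    D-outside t∈D (N-inside (subst (t ∈_) Q≡N (subst (λ R → t ∈ cl R) (start (tree-path Q R₀)) t∈Q)))
  ...       | inj₁ (suc j , j<len , (d' , d'∈D , d'∈Q₂) , untouched) =
    FirstContact.contradiction Q R₀ Q≡N N-max j j<len d'∈D d'∈Q₂ untouched

  neighbourhood-frequent : F Nₛ
  neighbourhood-frequent with F? Nₛ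
  ... | yes FN = FN
  ... | no ¬FN = ⊥-elim (¬maximal (infrequent-clique-maximal cs N-clique ¬FN))

module _ {K} {F : Family K} (anti : Antimonotonic F) (F? : ∀ U → Dec (F U)) (cs : CliqueSafe F)
  {m e} {cl : Fin m → Subset K} {edges : Fin e → Fin m × Fin m} (jt : JunctionTree F m e cl edges)
  {X : Subset K} (reach? : ∀ y t → Dec (Star (StepAvoiding F X) y t)) (X-bypass : BypassAdjacent F X) where

  open Cliques F F? using (Adj?)

  component : ∀ y → Comprehension (λ t → y ∉ X × Star (StepAvoiding F X) y t)
  component y = comprehension λ t → ¬? (y ∈? X) ×-dec reach? y t

  neighbourhood : ∀ y → Comprehension (λ c → c ∈ X × ∃[ d ] (d ∈ Comprehension.set (component y) × Adj F d c))
  neighbourhood y = comprehension λ c → (c ∈? X) ×-dec FinP.any? (λ d → (d ∈? Comprehension.set (component y)) ×-dec Adj? d c)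

  bypassAdjacent⇒componentsOutside : ComponentsOutside F X
  bypassAdjacent⇒componentsOutside = record
    { comp         = comp
    ; nb           = nb
    ; comp-self    = λ y∉X → complete (component _) (y∉X , ε)
    ; comp-outside = λ t∈D → avoiding-end F (proj₂ (sound (component _) t∈D)) (proj₁ (sound (component _) t∈D))
    ; comp-merge   = λ {y} {y'} t∈D t∈D' → complete (component y')
        (proj₁ (sound (component y') t∈D') ,
         proj₂ (sound (component y') t∈D') ◅◅ reverse (StepAvoiding-sym F) (proj₂ (sound (component y) t∈D)))
    ; nb-inside    = λ y → proj₁ ∘ sound (neighbourhood y)
    ; nb-frequent  = λ {y} y∉X → Neighbourhood.neighbourhood-frequent F? cs jt X-bypass y∉X (component y) (neighbourhood y)
    ; confined     = confined
    }
    where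
    open Comprehension
    comp nb : Fin K → Subset K
    comp y = set (component y)
    nb y = set (neighbourhood y)
    confined : ∀ {U} → F U → ∀ {y t} → y ∉ X → t ∈ U → t ∈ comp y → U ⊆ comp y ∪ nb y
    confined {U} FU {y} {t} y∉X t∈U t∈D {s} s∈U with s FinP.≟ t
    ... | yes refl = x∈p∪q⁺ (inj₁ t∈D)
    ... | no  s≢t with s ∈? X
    ...   | yes s∈X = x∈p∪q⁺ (inj₂ (complete (neighbourhood y) (s∈X , t , t∈D , t~s)))
      where
      t~s : Adj F t s
      t~s = itemset-Adj anti FU t∈U s∈U (s≢t ∘ sym)
    ...   | no  s∉X = x∈p∪q⁺ (inj₁ (complete (component y) (y∉X , y⇝t ◅◅ ((t~s , avoiding-end F y⇝t y∉X , s∉X) ◅ ε))))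
      where
      y⇝t : Star (StepAvoiding F X) y t
      y⇝t = proj₂ (sound (component y) t∈D)
      t~s : Adj F t s
      t~s = itemset-Adj anti FU t∈U s∈U (s≢t ∘ sym)

  bypassAdjacent⇒safe : Safe F X
  bypassAdjacent⇒safe = componentsOutside⇒safe anti bypassAdjacent⇒componentsOutside

corollary3 : ∀ {K : ℕ} (F : Family K) →
    Antimonotonic F → Triangulated F → CliqueSafe F → Connected (Adj F) →
    ∀ {m e : ℕ} (cl : Fin m → Subset K) (edges : Fin e → Fin m × Fin m) →
    JunctionTree F m e cl edges →
    ∀ (B C : Subset K) → MinSafeContaining F B C →
    ∀ (ch : CliqueChoice cl B) → MinimalChoice edges ch →
    ∀ (S : Subset e) → InnerSet edges ch S →
    ∀ x → x ∈ C → x ∈ B ⊎ (∃[ i ] (i ∈ S × x ∈ Sep cl edges i))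
corollary3 {K} F anti _ cs _ cl edges jt B C (C-safe , B⊆C , C-minimum) ch _ S S-inner x x∈C =
  -- The goal is decidable, so F
  -- and reachability may be decided classically.
  decidable-stable (admissible? x) λ x-inadmissible →
  ¬¬-decidable-subsets K F λ F? →
  ¬¬-decidable₂ K (Star (StepAvoiding F C∩A)) λ reach? →
  ℕP.<⇒≱ (p⊂q⇒∣p∣<∣q∣ (C∩A⊆C , x , x∈C , x-inadmissible ∘ proj₂ ∘ sound))
         (C-minimum C∩A (C∩A-safe F? reach?) B⊆C∩A)
  where
  admissible? : ∀ t → Dec (t ∈ B ⊎ ∃[ i ] (i ∈ S × t ∈ Sep cl edges i))
  admissible? t = (t ∈? B) ⊎-dec FinP.any? (λ i → (i ∈? S) ×-dec (t ∈? Sep cl edges i))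
  C∩A′ : Comprehension (λ t → t ∈ C × (t ∈ B ⊎ ∃[ i ] (i ∈ S × t ∈ Sep cl edges i)))
  C∩A′ = comprehension (λ t → (t ∈? C) ×-dec admissible? t)
  open Comprehension C∩A′ renaming (set to C∩A)
  C∩A⊆C : C∩A ⊆ C
  C∩A⊆C = proj₁ ∘ sound
  B⊆C∩A : B ⊆ C∩A
  B⊆C∩A b∈B = complete (B⊆C b∈B , inj₁ b∈B)
  C∩A-safe : (∀ U → Dec (F U)) → (∀ y t → Dec (Star (StepAvoiding F C∩A) y t)) → Safe F C∩A
  C∩A-safe F? reach? = bypassAdjacent⇒safe anti F? cs jt reach?
    (InnerSeparators.Restriction.bypassAdjacent-restrict F? jt ch S-inner C∩A′ (safe⇒bypassAdjacent anti C-safe))
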